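{- Let $C_1$ be a finite set of points on a circle, colored black and white so that, going around the circle, the colors repeat cyclically the pattern of length $16$: $2$ black, $4$ white, $6$ black and $4$ white points. Suppose all points of $C_1$ are covered by paths $P_1,\dots,P_t$ with vertices in $C_1$ that are pairwise vertex-disjoint, alternating (consecutive vertices have different colors) and non-crossing (all their edges, drawn as straight-line segments, are pairwise non-crossing). Then every leaf among $P_1,\dots,P_t$ has weight at most $3.5$.
   Context: An interval is a set of cyclically consecutive points of $C_1$ on the circle. A base of a path $P_i$ is a maximal interval all of whose points are vertices of $P_i$; a leaf is a path $P_i$ with exactly one base. A run is a maximal interval all of whose points have the same color. The weight $w(P)$ of a path $P$ is the sum over all runs $R$ of: $1$ if all points of $R$ are vertices of $P$, $1/2$ if some but not all points of $R$ are vertices of $P$, and $0$ otherwise. The periodicity on the circle means in particular that $|C_1|$ is a positive multiple of $16$. -}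

module Defs where

open import Data.Bool using (Bool; true; false; _∧_; _∨_; not; if_then_else_)
open import Data.Nat using (ℕ; zero; suc; _+_; _*_; _∸_; _≤_; _<_; _<ᵇ_; _≤ᵇ_; _%_)
open import Data.Nat.DivMod using (_mod_)
open import Data.Fin using (Fin; toℕ)
import Data.Fin as Fin
open import Data.List using (List; []; _∷_; map; upTo; concatMap; allFin)
open import Data.Nat.ListAction using (sum)
open import Data.Bool.ListAction using (all; any)
open import Data.List.Membership.Propositional using (_∈_)
open import Data.List.Relation.Unary.All using (All)
open import Data.List.Relation.Unary.AllPairs using (AllPairs)
open import Data.List.Relation.Unary.Unique.Propositional using (Unique)
import Data.Sum
import Data.Nat
open import Data.Product using (Σ; ∃; _×_; _,_)
open import Relation.Nullary using (¬_; does)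
open import Relation.Binary.PropositionalEquality using (_≡_; _≢_)

-- The circle: |C₁| = 16 * (suc k) points, labelled 0 … n-1 in cyclic
-- order around the circle (Fin n with its natural order is the cyclic
-- order).  Colours: true = black, false = white.

N : ℕ → ℕ
N k = 16 * suc k

pattern16 : ℕ → Bool
pattern16 r = (r <ᵇ 2) ∨ ((6 ≤ᵇ r) ∧ (r <ᵇ 12))

PeriodicColouring : (k : ℕ) → (Fin (N k) → Bool) → Set
PeriodicColouring k col = ∃ λ (o : ℕ) → ∀ (x : Fin (N k)) → col x ≡ pattern16 ((toℕ x + o) % 16)

module _ (k : ℕ) where

  n : ℕ
  n = N k

  Point : Set
  Point = Fin n

  pt : ℕ → Point
  pt i = i mod n

  interval : Point → ℕ → List Point
  interval s ℓ = map (λ j → pt (toℕ s + j)) (upTo ℓ)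

  -- paths are lists of vertices (in path order); edges join consecutive vertices
  edges : List Point → List (Point × Point)
  edges [] = []
  edges (a ∷ []) = []
  edges (a ∷ b ∷ xs) = (a , b) ∷ edges (b ∷ xs)

  -- straight-line chords between points in convex position cross iff
  -- their four endpoints are distinct and interleave in the cyclic order
  Crosses : Point × Point → Point × Point → Set
  Crosses (a , b) (c , d) =
    let a' = toℕ a Data.Nat.⊓ toℕ b ; b' = toℕ a Data.Nat.⊔ toℕ b
        c' = toℕ c Data.Nat.⊓ toℕ d ; d' = toℕ c Data.Nat.⊔ toℕ d
    in (a' < c' × c' < b' × b' < d') Data.Sum.⊎ (c' < a' × a' < d' × d' < b')

  IsAlternatingPath : (Point → Bool) → List Point → Set
  IsAlternatingPath col P =
    (P ≢ []) × Unique P × All (λ e → col (Data.Product.proj₁ e) ≢ col (Data.Product.proj₂ e)) (edges P)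

  Disjoint : List Point → List Point → Set
  Disjoint P Q = ∀ {x} → x ∈ P → ¬ (x ∈ Q)

  Covers : List (List Point) → Set
  Covers Ps = ∀ (x : Point) → ∃ λ P → (P ∈ Ps) × (x ∈ P)

  NonCrossing : List (List Point) → Set
  NonCrossing Ps = ∀ e f → e ∈ concatMap edges Ps → f ∈ concatMap edges Ps → ¬ Crosses e f

  ValidInterval : Point → ℕ → Set
  ValidInterval s ℓ = (1 ≤ ℓ) × (ℓ ≤ n)

  _⊆_ : List Point → List Point → Set
  A ⊆ B = ∀ {x} → x ∈ A → x ∈ B

  IsBase : List Point → Point → ℕ → Set
  IsBase P s ℓ =
    ValidInterval s ℓ × (interval s ℓ ⊆ P) ×
    (∀ s' ℓ' → ValidInterval s' ℓ' → interval s' ℓ' ⊆ P →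
       interval s ℓ ⊆ interval s' ℓ' → interval s' ℓ' ⊆ interval s ℓ)

  -- a leaf: exactly one base (bases compared as sets of points)
  IsLeaf : List Point → Set
  IsLeaf P = Σ Point λ s → Σ ℕ λ ℓ → IsBase P s ℓ ×
    (∀ s' ℓ' → IsBase P s' ℓ' → (interval s' ℓ' ⊆ interval s ℓ) × (interval s ℓ ⊆ interval s' ℓ'))

  _==_ : Bool → Bool → Bool
  true == b = b
  false == b = not b

  -- (s , ℓ) with 1 ≤ ℓ < n is a run: a monochromatic interval that is maximal,
  -- i.e. cannot be extended by the point before s or the point after it.
  -- Every run (a proper subset of the circle, since both colours occur)
  -- has exactly one such description (s , ℓ).
  isRun : (Point → Bool) → Point → ℕ → Bool
  isRun col s ℓ =
    (1 ≤ᵇ ℓ) ∧ (ℓ <ᵇ n) ∧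
    all (λ x → col x == col s) (interval s ℓ) ∧
    not (col (pt (toℕ s + ℓ)) == col s) ∧
    not (col (pt (toℕ s + (n ∸ 1))) == col s)

  _∈ᵇ_ : Point → List Point → Bool
  x ∈ᵇ P = any (λ y → does (x Fin.≟ y)) P

  -- twice the contribution of a run: 2 if all its points are in P,
  -- 1 if some but not all, 0 if none
  runScore2 : List Point → List Point → ℕ
  runScore2 P R =
    if all (λ x → x ∈ᵇ P) R then 2 else (if any (λ x → x ∈ᵇ P) R then 1 else 0)

  -- 2 · w(P)
  weight2 : (Point → Bool) → List Point → ℕ
  weight2 col P =
    sum (map (λ s → sum (map (λ ℓ → if isRun col s ℓ then runScore2 P (interval s ℓ) else 0)
                             (upTo n)))
             (allFin n))

module Submission where

-- All vertices of a leaf P lie in its unique base (module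
-- Bases), and the base lies in P, so P fills an interval of ℓ consecutive
-- points.  Cut the base open just after the first vertex v₁ of P.  A
-- non-crossing path that starts outside an interval and fills it exactly must
-- enter it at one of its ends, and then recursively (peelPath): the rest of P
-- "peels" the cut base from its two ends with alternating colours.  For the
-- periodic pattern no interval of 10 consecutive points can be peeled (a
-- finite check, module Windows); a straddling argument extends this to cut
-- bases with ℓ ≥ 20 (module SplitWindow), and an exhaustive computation over
-- the remaining ℓ ≤ 19 shows that a peelable base has ℓ ≤ 15 and window weight
-- at most 7 (module PeelableBases).  Finally twice the weight of a path inside
-- a window is bounded by that window weight (module WeightBound).
--
-- Relabelling the base by natural numbers turns crossings on the circle into
-- crossings on a line; this uses that crossing is invariant under rotation
-- (modules Rotation and MinMaxCrossing).

open import Data.Bool using (Bool; true; false; not; _∧_; _∨_; _xor_; if_then_else_; T)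
open import Data.Nat using (ℕ; zero; suc; _+_; _*_; _∸_; _≤_; _<_; z≤n; s≤s; z<s; _≟_; _<?_; _≤?_;
  _<ᵇ_; _≤ᵇ_; _%_; NonZero)
open import Data.Nat.Properties
open import Data.List using (List; []; _∷_; map)
open import Data.Fin using (Fin; toℕ)
open import Data.List.Membership.Propositional using (_∈_)
open import Data.List.Relation.Unary.Any using (here; there)
open import Data.List.Relation.Unary.All using (All; []; _∷_; lookup)
open import Data.List.Relation.Unary.AllPairs using (AllPairs; []; _∷_)
open import Data.List.Relation.Unary.Unique.Propositional using (Unique)
open import Data.Product using (Σ; ∃; _×_; _,_; proj₁; proj₂)
open import Data.Sum using (_⊎_; inj₁; inj₂)
open import Data.Empty using (⊥; ⊥-elim)
open import Relation.Nullary using (¬_; Dec; yes; no; does)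
open import Relation.Binary.PropositionalEquality
import Defs

-- Chords between points 0, 1, 2, … placed in this order on a line (or,
-- after cutting the circle open, on an arc).  A path is a list of
-- vertices; its edges join consecutive vertices.
module Chords where

  edgesN : List ℕ → List (ℕ × ℕ)
  edgesN [] = []
  edgesN (a ∷ []) = []
  edgesN (a ∷ b ∷ xs) = (a , b) ∷ edgesN (b ∷ xs)

  edgesN-tail : ∀ x ys {e} → e ∈ edgesN ys → e ∈ edgesN (x ∷ ys)
  edgesN-tail x [] ()
  edgesN-tail x (y ∷ ys) e∈ = there e∈

  Btw : ℕ → ℕ → ℕ → Set
  Btw a b z = (a < z × z < b) ⊎ (b < z × z < a)

  Btw? : ∀ a b z → Dec (Btw a b z)
  Btw? a b z with a <? z | z <? b | b <? z | z <? a
  ... | yes p | yes q | _ | _ = yes (inj₁ (p , q))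
  ... | _ | _ | yes p | yes q = yes (inj₂ (p , q))
  ... | no p | _ | no r | _ = no λ { (inj₁ (x , _)) → p x ; (inj₂ (x , _)) → r x }
  ... | no p | _ | yes r | no s = no λ { (inj₁ (x , _)) → p x ; (inj₂ (_ , y)) → s y }
  ... | yes p | no q | no r | _ = no λ { (inj₁ (_ , y)) → q y ; (inj₂ (x , _)) → r x }
  ... | yes p | no q | yes r | no s = no λ { (inj₁ (_ , y)) → q y ; (inj₂ (_ , y)) → s y }

  Xc : ℕ × ℕ → ℕ × ℕ → Set
  Xc (a , b) (c , d) = (c ≢ a) × (c ≢ b) × (d ≢ a) × (d ≢ b) ×
    ((Btw a b c × ¬ Btw a b d) ⊎ (¬ Btw a b c × Btw a b d))

  NonCrossingN : List ℕ → Set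
  NonCrossingN ws = ∀ e f → e ∈ edgesN ws → f ∈ edgesN ws → ¬ Xc e f

  AlternatingN : (ℕ → Bool) → List ℕ → Set
  AlternatingN C ws = All (λ e → C (proj₁ e) ≢ C (proj₂ e)) (edgesN ws)

  SameSide : ℕ → ℕ → ℕ → ℕ → Set
  SameSide a x z₁ z₂ = (Btw a x z₁ → Btw a x z₂) × (Btw a x z₂ → Btw a x z₁)

  AvoidsEnds : ℕ → ℕ → List ℕ → Set
  AvoidsEnds a x zs = ∀ y → y ∈ zs → (y ≢ a) × (y ≢ x)

  edgeSameSide : ∀ a x z₁ z₂ → (z₁ ≢ a) × (z₁ ≢ x) → (z₂ ≢ a) × (z₂ ≢ x) →
    ¬ Xc (a , x) (z₁ , z₂) → SameSide a x z₁ z₂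
  edgeSameSide a x z₁ z₂ (z₁a , z₁x) (z₂a , z₂x) nc = forth , back
    where
    forth : Btw a x z₁ → Btw a x z₂
    forth b₁ with Btw? a x z₂
    ... | yes b₂ = b₂
    ... | no nb₂ = ⊥-elim (nc (z₁a , z₁x , z₂a , z₂x , inj₁ (b₁ , nb₂)))
    back : Btw a x z₂ → Btw a x z₁
    back b₂ with Btw? a x z₁
    ... | yes b₁ = b₁
    ... | no nb₁ = ⊥-elim (nc (z₁a , z₁x , z₂a , z₂x , inj₂ (nb₁ , b₂)))

  pathSameSide : ∀ a x z zs → AvoidsEnds a x (z ∷ zs) →
    (∀ f → f ∈ edgesN (z ∷ zs) → ¬ Xc (a , x) f) →
    ∀ y → y ∈ z ∷ zs → SameSide a x z y
  pathSameSide a x z zs avoid nc y (here refl) = (λ b → b) , (λ b → b)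
  pathSameSide a x z (z₂ ∷ zs) avoid nc y (there y∈) =
    (λ b → proj₁ rest (proj₁ step b)) , (λ b → proj₂ step (proj₂ rest b))
    where
    step : SameSide a x z z₂
    step = edgeSameSide a x z z₂ (avoid z (here refl)) (avoid z₂ (there (here refl)))
             (nc (z , z₂) (here refl))
    rest : SameSide a x z₂ y
    rest = pathSameSide a x z₂ zs (λ y m → avoid y (there m)) (λ f m → nc f (there m)) y y∈

  sameSide : ∀ a x zs → AvoidsEnds a x zs → (∀ f → f ∈ edgesN zs → ¬ Xc (a , x) f) →
    ∀ y₁ y₂ → y₁ ∈ zs → y₂ ∈ zs → Btw a x y₁ → Btw a x y₂
  sameSide a x (z ∷ zs) avoid nc y₁ y₂ y₁∈ y₂∈ b =
    proj₁ (pathSameSide a x z zs avoid nc y₂ y₂∈) (proj₂ (pathSameSide a x z zs avoid nc y₁ y₁∈) b)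

  -- a chord from a point outside the interval [lo, hi] to a point strictly
  -- inside separates lo from hi, so no path avoiding the chord visits both
  innerChordSeparates : ∀ prev x ys lo hi → (prev < lo) ⊎ (hi < prev) → lo < x → x < hi →
    AvoidsEnds prev x ys → (∀ f → f ∈ edgesN ys → ¬ Xc (prev , x) f) →
    lo ∈ ys → hi ∈ ys → ⊥
  innerChordSeparates prev x ys lo hi (inj₁ prev<lo) lo<x x<hi avoid nc lo∈ hi∈
    with sameSide prev x ys avoid nc lo hi lo∈ hi∈ (inj₁ (prev<lo , lo<x))
  ... | inj₁ (_ , hi<x) = <-asym hi<x x<hi
  ... | inj₂ (_ , hi<prev) = <-asym hi<prev (<-trans prev<lo (<-trans lo<x x<hi))
  innerChordSeparates prev x ys lo hi (inj₂ hi<prev) lo<x x<hi avoid nc lo∈ hi∈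
    with sameSide prev x ys avoid nc hi lo hi∈ lo∈ (inj₂ (x<hi , hi<prev))
  ... | inj₁ (prev<lo , _) = <-asym prev<lo (<-trans lo<x (<-trans x<hi hi<prev))
  ... | inj₂ (x<lo , _) = <-asym x<lo lo<x

  -- Peel C lo len c: the interval [lo, lo + len) can be emptied by
  -- repeatedly removing its lowest or its highest point, the colours of the
  -- removed points alternating, starting with a colour different from c
  data Peel (C : ℕ → Bool) : ℕ → ℕ → Bool → Set where
    pdone : ∀ {lo c} → Peel C lo 0 c
    pleft : ∀ {lo len c} → C lo ≢ c → Peel C (suc lo) len (C lo) → Peel C lo (suc len) c
    pright : ∀ {lo len c} → C (lo + len) ≢ c → Peel C lo len (C (lo + len)) → Peel C lo (suc len) c

  Fills : List ℕ → ℕ → ℕ → Set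
  Fills xs lo len = (∀ z → z ∈ xs → lo ≤ z × z < lo + len) × (∀ z → lo ≤ z → z < lo + len → z ∈ xs)

  outside : ∀ prev lo len → (∀ z → lo ≤ z → z < lo + len → z ≢ prev) → (prev < lo) ⊎ (lo + len ≤ prev)
  outside prev lo len avoid with prev <? lo
  ... | yes p = inj₁ p
  ... | no np with lo + len ≤? prev
  ...   | yes q = inj₂ q
  ...   | no nq = ⊥-elim (avoid prev (≮⇒≥ np) (≰⇒> nq) refl)

  -- A non-crossing alternating path prev ∷ xs whose first
  -- vertex lies outside an interval that the rest of the path fills exactly
  -- must enter the interval at one of its ends, and then recursively: its
  -- vertices peel the interval from the ends.
  peelPath : (C : ℕ → Bool) (prev : ℕ) (xs : List ℕ) (lo len : ℕ) → Fills xs lo len →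
    Unique (prev ∷ xs) → NonCrossingN (prev ∷ xs) → AlternatingN C (prev ∷ xs) →
    Peel C lo len (C prev)
  peelPath C prev [] lo zero _ _ _ _ = pdone
  peelPath C prev [] lo (suc len) (_ , cover) _ _ _ with cover lo ≤-refl (m<m+n lo z<s)
  ... | ()
  peelPath C prev (x ∷ ys) lo zero (inside , _) _ _ _ =
    ⊥-elim (<⇒≱ (proj₂ (inside x (here refl))) (subst (_≤ x) (sym (+-identityʳ lo)) (proj₁ (inside x (here refl)))))
  peelPath C prev (x ∷ ys) lo (suc len) (inside , cover) (prev∉ ∷ u) nc (alt₁ ∷ alt) =
    enter (x ≟ lo) (x ≟ lo + len)
    where
    x∉ys : ∀ z → z ∈ ys → z ≢ x
    x∉ys z z∈ e = lookup (Data.List.Relation.Unary.AllPairs.head u) (subst (_∈ ys) e z∈) refl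
    coverRest : ∀ z → lo ≤ z → z < lo + suc len → z ≢ x → z ∈ ys
    coverRest z lo≤z z< z≢x with cover z lo≤z z<
    ... | here e = ⊥-elim (z≢x e)
    ... | there z∈ = z∈
    ncTail : NonCrossingN (x ∷ ys)
    ncTail e f e∈ f∈ = nc e f (there e∈) (there f∈)
    enter : Dec (x ≡ lo) → Dec (x ≡ lo + len) → Peel C lo (suc len) (C prev)
    enter (yes refl) _ = pleft (λ e → alt₁ (sym e)) (peelPath C x ys (suc lo) len fillsRight u ncTail alt)
      where
      fillsRight : Fills ys (suc lo) len
      fillsRight = (λ z z∈ → ≤∧≢⇒< (proj₁ (inside z (there z∈))) (λ e → x∉ys z z∈ (sym e)) ,
                             subst (z <_) (+-suc lo len) (proj₂ (inside z (there z∈)))) ,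
                   (λ z lo<z z< → coverRest z (<⇒≤ lo<z) (subst (z <_) (sym (+-suc lo len)) z<) (λ e → <-irrefl (sym e) lo<z))
    enter (no _) (yes refl) = pright (λ e → alt₁ (sym e)) (peelPath C x ys lo len fillsLeft u ncTail alt)
      where
      fillsLeft : Fills ys lo len
      fillsLeft = (λ z z∈ → proj₁ (inside z (there z∈)) ,
                            ≤∧≢⇒< (≤-pred (subst (z <_) (+-suc lo len) (proj₂ (inside z (there z∈))))) (x∉ys z z∈)) ,
                  (λ z lo≤z z< → coverRest z lo≤z (≤-trans z< (+-monoʳ-≤ lo (n≤1+n len))) (λ e → <-irrefl e z<))
    enter (no x≢lo) (no x≢hi) =
      ⊥-elim (innerChordSeparates prev x ys lo (lo + len) prevOutside
                (≤∧≢⇒< (proj₁ x∈) (λ e → x≢lo (sym e))) (≤∧≢⇒< x≤hi x≢hi) avoid ncChord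
                (coverRest lo ≤-refl (m<m+n lo z<s) (λ e → x≢lo (sym e)))
                (coverRest (lo + len) (m≤m+n lo len) hi<end (λ e → x≢hi (sym e))))
      where
      x∈ : lo ≤ x × x < lo + suc len
      x∈ = inside x (here refl)
      x≤hi : x ≤ lo + len
      x≤hi = ≤-pred (subst (x <_) (+-suc lo len) (proj₂ x∈))
      hi<end : lo + len < lo + suc len
      hi<end = subst (lo + len <_) (sym (+-suc lo len)) (n<1+n _)
      prevOutside : (prev < lo) ⊎ (lo + len < prev)
      prevOutside with outside prev lo (suc len) (λ z lo≤z z< e → lookup prev∉ (subst (_∈ x ∷ ys) e (cover z lo≤z z<)) refl)
      ... | inj₁ p = inj₁ p
      ... | inj₂ q = inj₂ (<-≤-trans hi<end q)
      avoid : AvoidsEnds prev x ys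
      avoid y y∈ = (λ e → lookup prev∉ (there (subst (_∈ ys) e y∈)) refl) , x∉ys y y∈
      ncChord : ∀ f → f ∈ edgesN ys → ¬ Xc (prev , x) f
      ncChord f f∈ = nc (prev , x) f (here refl) (there (edgesN-tail x ys f∈))

module BoolFacts where

  open import Data.Unit using (tt)

  T⇒≡true : ∀ {b} → T b → b ≡ true
  T⇒≡true {true} _ = refl

  ≡true⇒T : ∀ {b} → b ≡ true → T b
  ≡true⇒T refl = tt

  T-ext : ∀ {a b} → (T a → T b) → (T b → T a) → a ≡ b
  T-ext {true} {true} f g = refl
  T-ext {true} {false} f g = ⊥-elim (f tt)
  T-ext {false} {true} f g = ⊥-elim (g tt)
  T-ext {false} {false} f g = refl

  <ᵇ-true : ∀ {x y} → x < y → (x <ᵇ y) ≡ true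
  <ᵇ-true x<y = T⇒≡true (<⇒<ᵇ x<y)

  <ᵇ-false : ∀ {x y} → ¬ (x < y) → (x <ᵇ y) ≡ false
  <ᵇ-false {x} {y} x≮y with x <ᵇ y in eq
  ... | true = ⊥-elim (x≮y (<ᵇ⇒< x y (≡true⇒T eq)))
  ... | false = refl

  ∧-true₁ : ∀ {a b} → a ∧ b ≡ true → a ≡ true
  ∧-true₁ {true} _ = refl

  ∧-true₂ : ∀ {a b} → a ∧ b ≡ true → b ≡ true
  ∧-true₂ {true} e = e

  ∧-intro : ∀ {a b} → a ≡ true → b ≡ true → a ∧ b ≡ true
  ∧-intro refl refl = refl

  ∨-introˡ : ∀ {a} b → a ≡ true → a ∨ b ≡ true
  ∨-introˡ b refl = refl

  ∨-introʳ : ∀ a {b} → b ≡ true → a ∨ b ≡ true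
  ∨-introʳ true refl = refl
  ∨-introʳ false refl = refl

  ∨-resolve : ∀ {a b} → a ∨ b ≡ true → a ≢ true → b ≡ true
  ∨-resolve {true} _ a≢ = ⊥-elim (a≢ refl)
  ∨-resolve {false} e _ = e

  not-true⇒¬ : ∀ {b} → not b ≡ true → b ≢ true
  not-true⇒¬ {true} () _
  not-true⇒¬ {false} _ ()

  xor-≢ : ∀ {a b} → a ≢ b → a xor b ≡ true
  xor-≢ {true} {true} ne = ⊥-elim (ne refl)
  xor-≢ {true} {false} ne = refl
  xor-≢ {false} {true} ne = refl
  xor-≢ {false} {false} ne = ⊥-elim (ne refl)

  xor-false⇒≡ : ∀ {a b} → a xor b ≡ false → a ≡ b
  xor-false⇒≡ {true} {true} _ = refl
  xor-false⇒≡ {false} {false} _ = refl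

  not-xor-self : ∀ a → not (a xor a) ≡ true
  not-xor-self true = refl
  not-xor-self false = refl

-- Comparisons between rotated points flip
-- exactly when one of the two points wraps around, which cancels out in
-- the crossing condition.
module Rotation where

  open Chords
  open BoolFacts
  open import Data.Nat.DivMod
  import Data.Bool.Properties as BoolP

  btwB : ℕ → ℕ → ℕ → Bool
  btwB a b z = ((a <ᵇ z) ∧ (z <ᵇ b)) ∨ ((b <ᵇ z) ∧ (z <ᵇ a))

  btw⇒btwB : ∀ {a b z} → Btw a b z → btwB a b z ≡ true
  btw⇒btwB {a} {b} {z} (inj₁ (p , q)) rewrite <ᵇ-true p | <ᵇ-true q = refl
  btw⇒btwB {a} {b} {z} (inj₂ (p , q)) rewrite <ᵇ-true p | <ᵇ-true q = BoolP.∨-zeroʳ _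

  btwB⇒btw : ∀ {a b z} → btwB a b z ≡ true → Btw a b z
  btwB⇒btw {a} {b} {z} e with (a <ᵇ z) ∧ (z <ᵇ b) in e₁
  ... | true = inj₁ (<ᵇ⇒< a z (≡true⇒T (∧-true₁ e₁)) , <ᵇ⇒< z b (≡true⇒T (∧-true₂ {a <ᵇ z} e₁)))
  ... | false = inj₂ (<ᵇ⇒< b z (≡true⇒T (∧-true₁ e)) , <ᵇ⇒< z a (≡true⇒T (∧-true₂ {b <ᵇ z} e)))

  ¬btw⇒btwB : ∀ {a b z} → ¬ Btw a b z → btwB a b z ≡ false
  ¬btw⇒btwB {a} {b} {z} nb with btwB a b z in e
  ... | true = ⊥-elim (nb (btwB⇒btw e))
  ... | false = refl

  btwB-false⇒¬btw : ∀ {a b z} → btwB a b z ≡ false → ¬ Btw a b z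
  btwB-false⇒¬btw e bt with trans (sym (btw⇒btwB bt)) e
  ... | ()

  <ᵇ-flip : ∀ {x y} → x ≢ y → (y <ᵇ x) ≡ not (x <ᵇ y)
  <ᵇ-flip {x} {y} x≢y with x <? y
  ... | yes x<y rewrite <ᵇ-true x<y = <ᵇ-false (λ y<x → <-asym x<y y<x)
  ... | no x≮y with y <? x
  ...   | yes y<x rewrite <ᵇ-false x≮y = <ᵇ-true y<x
  ...   | no y≮x = ⊥-elim (x≢y (≤-antisym (≮⇒≥ y≮x) (≮⇒≥ x≮y)))

  ∸-reflect-< : ∀ {K x y} → K ≤ x → K ≤ y → x ∸ K < y ∸ K → x < y
  ∸-reflect-< {K} {x} {y} K≤x K≤y lt = subst₂ _<_ (m∸n+n≡m K≤x) (m∸n+n≡m K≤y) (+-monoˡ-< K lt)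

  -- the crossing condition, written with xor, is unchanged when the betweenness
  -- tests u = (a < z), v = (z < b) are flipped by the wrapping flags ga, gb, gz
  btw-xor : ∀ u v ga gb gz →
    (((u xor (ga xor gz)) ∧ (v xor (gz xor gb))) ∨ (((not v) xor (gb xor gz)) ∧ ((not u) xor (gz xor ga))))
      ≡ (((u ∧ v) ∨ (not v ∧ not u)) xor (ga xor gb))
  btw-xor true true true true true = refl
  btw-xor true true true true false = refl
  btw-xor true true true false true = refl
  btw-xor true true true false false = refl
  btw-xor true true false true true = refl
  btw-xor true true false true false = refl
  btw-xor true true false false true = refl
  btw-xor true true false false false = refl
  btw-xor true false true true true = refl
  btw-xor true false true true false = refl
  btw-xor true false true false true = refl
  btw-xor true false true false false = refl
  btw-xor true false false true true = refl
  btw-xor true false false true false = refl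
  btw-xor true false false false true = refl
  btw-xor true false false false false = refl
  btw-xor false true true true true = refl
  btw-xor false true true true false = refl
  btw-xor false true true false true = refl
  btw-xor false true true false false = refl
  btw-xor false true false true true = refl
  btw-xor false true false true false = refl
  btw-xor false true false false true = refl
  btw-xor false true false false false = refl
  btw-xor false false true true true = refl
  btw-xor false false true true false = refl
  btw-xor false false true false true = refl
  btw-xor false false true false false = refl
  btw-xor false false false true true = refl
  btw-xor false false false true false = refl
  btw-xor false false false false true = refl
  btw-xor false false false false false = refl

  xor-split : ∀ x y G → (x xor G) ≡ true → (y xor G) ≡ false →
    ((x ≡ true) × (y ≡ false)) ⊎ ((x ≡ false) × (y ≡ true))
  xor-split true false false _ _ = inj₁ (refl , refl)
  xor-split false true true _ _ = inj₂ (refl , refl)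
  xor-split true true false _ ()
  xor-split true true true () _
  xor-split false false false () _
  xor-split false false true _ ()
  xor-split true false true () _
  xor-split false true false () _

  module Rotate (K m : ℕ) where

    rot : ℕ → ℕ
    rot x = if x <ᵇ K then x + m else x ∸ K

    wraps : ℕ → Bool
    wraps x = not (x <ᵇ K)

    rot-low : ∀ {x} → x < K → rot x ≡ x + m
    rot-low x<K rewrite <ᵇ-true x<K = refl

    rot-high : ∀ {x} → ¬ (x < K) → rot x ≡ x ∸ K
    rot-high x≮K rewrite <ᵇ-false x≮K = refl

    rot-mod : ∀ M → .{{_ : NonZero M}} → K + m ≡ M → ∀ x → x < M → (x + m) % M ≡ rot x
    rot-mod M refl x x<M with x <? K
    ... | yes x<K = trans (m<n⇒m%n≡m (+-monoˡ-< m x<K)) (sym (rot-low x<K))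
    ... | no x≮K = begin
        (x + m) % (K + m)               ≡⟨ cong (λ z → (z + m) % (K + m)) (sym (m∸n+n≡m (≮⇒≥ x≮K))) ⟩
        ((x ∸ K) + K + m) % (K + m)     ≡⟨ cong (_% (K + m)) (+-assoc (x ∸ K) K m) ⟩
        ((x ∸ K) + (K + m)) % (K + m)   ≡⟨ [m+n]%n≡m%n (x ∸ K) (K + m) ⟩
        (x ∸ K) % (K + m)               ≡⟨ m<n⇒m%n≡m (≤-<-trans (m∸n≤m x K) x<M) ⟩
        x ∸ K                           ≡⟨ rot-high x≮K ⟨
        rot x ∎
      where open ≡-Reasoning

    unrot-rot : ∀ M → .{{_ : NonZero M}} → K + m ≡ M → ∀ x → x < M → (rot x + K) % M ≡ x
    unrot-rot M refl x x<M with x <? K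
    ... | yes x<K = begin
      (rot x + K) % (K + m)     ≡⟨ cong (λ z → (z + K) % (K + m)) (rot-low x<K) ⟩
      (x + m + K) % (K + m)     ≡⟨ cong (_% (K + m)) (trans (+-assoc x m K) (cong (x +_) (+-comm m K))) ⟩
      (x + (K + m)) % (K + m)   ≡⟨ [m+n]%n≡m%n x (K + m) ⟩
      x % (K + m)               ≡⟨ m<n⇒m%n≡m x<M ⟩
      x ∎
      where open ≡-Reasoning
    ... | no x≮K = trans (cong (λ z → (z + K) % (K + m)) (rot-high x≮K))
                     (trans (cong (_% (K + m)) (m∸n+n≡m (≮⇒≥ x≮K))) (m<n⇒m%n≡m x<M))

    rot-unrot : ∀ M → .{{_ : NonZero M}} → K + m ≡ M → ∀ z → z < M → rot ((z + K) % M) ≡ z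
    rot-unrot M refl z z<M with z + K <? K + m
    ... | yes lt = trans (cong rot (m<n⇒m%n≡m lt))
                     (trans (rot-high (λ l → <-irrefl refl (≤-<-trans (m≤n+m K z) l))) (m+n∸n≡m z K))
    ... | no nlt = trans (cong rot wrapped) (trans (rot-low z∸m<K) (m∸n+n≡m m≤z))
      where
      m≤z : m ≤ z
      m≤z = +-cancelʳ-≤ K m z (subst (_≤ z + K) (+-comm K m) (≮⇒≥ nlt))
      z∸m<K : z ∸ m < K
      z∸m<K = +-cancelʳ-< m (z ∸ m) K (subst (_< K + m) (sym (m∸n+n≡m m≤z)) z<M)
      wrapped : (z + K) % (K + m) ≡ z ∸ m
      wrapped = begin
        (z + K) % (K + m)             ≡⟨ cong (λ w → (w + K) % (K + m)) (m∸n+n≡m m≤z) ⟨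
        (z ∸ m + m + K) % (K + m)     ≡⟨ cong (_% (K + m)) (trans (+-assoc (z ∸ m) m K) (cong (z ∸ m +_) (+-comm m K))) ⟩
        (z ∸ m + (K + m)) % (K + m)   ≡⟨ [m+n]%n≡m%n (z ∸ m) (K + m) ⟩
        (z ∸ m) % (K + m)             ≡⟨ m<n⇒m%n≡m (<-≤-trans z∸m<K (m≤m+n K m)) ⟩
        z ∸ m ∎
        where open ≡-Reasoning

    rot-<ᵇ : ∀ x y → x < K + m → y < K + m → (rot x <ᵇ rot y) ≡ ((x <ᵇ y) xor (wraps x xor wraps y))
    rot-<ᵇ x y xM yM with x <? K | y <? K
    ... | yes xK | yes yK rewrite <ᵇ-true xK | <ᵇ-true yK =
      trans (T-ext (λ t → ≡true⇒T (<ᵇ-true (+-cancelʳ-< m x y (<ᵇ⇒< _ _ t))))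
                   (λ t → ≡true⇒T (<ᵇ-true {x + m} {y + m} (+-monoˡ-< m (<ᵇ⇒< x y t)))))
            (sym (BoolP.xor-identityʳ _))
    ... | no xK | no yK rewrite <ᵇ-false xK | <ᵇ-false yK =
      trans (T-ext (λ t → ≡true⇒T (<ᵇ-true (∸-reflect-< (≮⇒≥ xK) (≮⇒≥ yK) (<ᵇ⇒< _ _ t))))
                   (λ t → ≡true⇒T (<ᵇ-true {x ∸ K} {y ∸ K} (∸-monoˡ-< (<ᵇ⇒< x y t) (≮⇒≥ xK)))))
            (sym (BoolP.xor-identityʳ _))
    ... | no xK | yes yK rewrite <ᵇ-false xK | <ᵇ-true yK
           | <ᵇ-true {x ∸ K} {y + m} (≤-trans (+-cancelˡ-< K _ _ (subst (_< K + m) (sym (m+[n∸m]≡n (≮⇒≥ xK))) xM)) (m≤n+m m y))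
           | <ᵇ-false {x} {y} (λ l → xK (<-trans l yK)) = refl
    ... | yes xK | no yK rewrite <ᵇ-true xK | <ᵇ-false yK
           | <ᵇ-false {x + m} {y ∸ K} (λ l → <-irrefl refl (<-trans l (≤-trans (+-cancelˡ-< K _ _
                 (subst (_< K + m) (sym (m+[n∸m]≡n (≮⇒≥ yK))) yM)) (m≤n+m m x))))
           | <ᵇ-true {x} {y} (<-≤-trans xK (≮⇒≥ yK)) = refl

    rot-btw : ∀ a b z → a < K + m → b < K + m → z < K + m → z ≢ a → z ≢ b →
      btwB (rot a) (rot b) (rot z) ≡ (btwB a b z xor (wraps a xor wraps b))
    rot-btw a b z aM bM zM za zb
      rewrite rot-<ᵇ a z aM zM | rot-<ᵇ z b zM bM | rot-<ᵇ b z bM zM | rot-<ᵇ z a zM aM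
            | <ᵇ-flip {a} {z} (λ e → za (sym e)) | <ᵇ-flip {z} {b} zb =
      btw-xor (a <ᵇ z) (z <ᵇ b) (wraps a) (wraps b) (wraps z)

    rot-reflects-crossing : ∀ a b c d → a < K + m → b < K + m → c < K + m → d < K + m →
      Xc (rot a , rot b) (rot c , rot d) → Xc (a , b) (c , d)
    rot-reflects-crossing a b c d aM bM cM dM (ca , cb , da , db , interleave) =
      ca' , cb' , da' , db' , unrotate interleave
      where
      ca' : c ≢ a
      ca' e = ca (cong rot e)
      cb' : c ≢ b
      cb' e = cb (cong rot e)
      da' : d ≢ a
      da' e = da (cong rot e)
      db' : d ≢ b
      db' e = db (cong rot e)
      G : Bool
      G = wraps a xor wraps b
      toBtw : ((btwB a b c ≡ true) × (btwB a b d ≡ false)) ⊎ ((btwB a b c ≡ false) × (btwB a b d ≡ true)) →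
              (Btw a b c × ¬ Btw a b d) ⊎ (¬ Btw a b c × Btw a b d)
      toBtw (inj₁ (x , y)) = inj₁ (btwB⇒btw x , btwB-false⇒¬btw y)
      toBtw (inj₂ (x , y)) = inj₂ (btwB-false⇒¬btw x , btwB⇒btw y)
      unrotate : (Btw (rot a) (rot b) (rot c) × ¬ Btw (rot a) (rot b) (rot d)) ⊎
                 (¬ Btw (rot a) (rot b) (rot c) × Btw (rot a) (rot b) (rot d)) →
                 (Btw a b c × ¬ Btw a b d) ⊎ (¬ Btw a b c × Btw a b d)
      unrotate (inj₁ (x , y)) =
        toBtw (xor-split _ _ G (trans (sym (rot-btw a b c aM bM cM ca' cb')) (btw⇒btwB x))
                               (trans (sym (rot-btw a b d aM bM dM da' db')) (¬btw⇒btwB y)))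
      unrotate (inj₂ (x , y)) with xor-split _ _ G (trans (sym (rot-btw a b d aM bM dM da' db')) (btw⇒btwB y))
                                                 (trans (sym (rot-btw a b c aM bM cM ca' cb')) (¬btw⇒btwB x))
      ... | inj₁ (p , q) = toBtw (inj₂ (q , p))
      ... | inj₂ (p , q) = toBtw (inj₁ (q , p))

module MinMaxCrossing where

  open Chords
  open import Data.Nat using (_⊓_; _⊔_)

  Interleaves : ℕ → ℕ → ℕ → ℕ → Set
  Interleaves lo hi c' d' = (lo < c' × c' < hi × hi < d') ⊎ (c' < lo × lo < d' × d' < hi)

  CrossesN : ℕ × ℕ → ℕ × ℕ → Set
  CrossesN (a , b) (c , d) = Interleaves (a ⊓ b) (a ⊔ b) (c ⊓ d) (c ⊔ d)

  btw⇒min<max : ∀ a b z → Btw a b z → (a ⊓ b < z) × (z < a ⊔ b)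
  btw⇒min<max a b z (inj₁ (p , q)) = ≤-<-trans (m⊓n≤m a b) p , <-≤-trans q (m≤n⊔m a b)
  btw⇒min<max a b z (inj₂ (p , q)) = ≤-<-trans (m⊓n≤n a b) p , <-≤-trans q (m≤m⊔n a b)

  min<max⇒btw : ∀ a b z → (a ⊓ b < z) → (z < a ⊔ b) → Btw a b z
  min<max⇒btw a b z p q with a ≤? b
  ... | yes a≤b = inj₁ (subst (_< z) (m≤n⇒m⊓n≡m a≤b) p , subst (z <_) (m≤n⇒m⊔n≡n a≤b) q)
  ... | no a≰b = let b≤a = ≰⇒≥ a≰b in inj₂ (subst (_< z) (m≥n⇒m⊓n≡n b≤a) p , subst (z <_) (m≥n⇒m⊔n≡m b≤a) q)

  ≢min : ∀ {a b z} → z ≢ a → z ≢ b → z ≢ a ⊓ b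
  ≢min {a} {b} za zb e with ⊓-sel a b
  ... | inj₁ x = za (trans e x)
  ... | inj₂ x = zb (trans e x)

  ≢max : ∀ {a b z} → z ≢ a → z ≢ b → z ≢ a ⊔ b
  ≢max {a} {b} za zb e with ⊔-sel a b
  ... | inj₁ x = za (trans e x)
  ... | inj₂ x = zb (trans e x)

  insideOutside : ∀ lo hi c d → d ≢ lo → d ≢ hi → lo < c → c < hi → ¬ ((lo < d) × (d < hi)) →
    Interleaves lo hi (c ⊓ d) (c ⊔ d)
  insideOutside lo hi c d dlo dhi lo<c c<hi d-out with c ≤? d
  ... | yes c≤d rewrite m≤n⇒m⊓n≡m c≤d | m≤n⇒m⊔n≡n c≤d = inj₁ (lo<c , c<hi , hi<d)
    where
    hi<d : hi < d
    hi<d with hi <? d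
    ... | yes x = x
    ... | no x = ⊥-elim (d-out (<-≤-trans lo<c c≤d , ≤∧≢⇒< (≮⇒≥ x) dhi))
  ... | no c≰d rewrite m≥n⇒m⊓n≡n (≰⇒≥ c≰d) | m≥n⇒m⊔n≡m (≰⇒≥ c≰d) = inj₂ (d<lo , lo<c , c<hi)
    where
    d<lo : d < lo
    d<lo with d <? lo
    ... | yes x = x
    ... | no x = ⊥-elim (d-out (≤∧≢⇒< (≮⇒≥ x) (λ e → dlo (sym e)) , <-trans (≰⇒> c≰d) c<hi))

  Xc⇒CrossesN : ∀ a b c d → Xc (a , b) (c , d) → CrossesN (a , b) (c , d)
  Xc⇒CrossesN a b c d (ca , cb , da , db , inj₁ (c-in , d-out)) =
    let (p , q) = btw⇒min<max a b c c-in in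
    insideOutside (a ⊓ b) (a ⊔ b) c d (≢min da db) (≢max da db) p q (λ (x , y) → d-out (min<max⇒btw a b d x y))
  Xc⇒CrossesN a b c d (ca , cb , da , db , inj₂ (c-out , d-in)) =
    let (p , q) = btw⇒min<max a b d d-in in
    subst₂ (Interleaves (a ⊓ b) (a ⊔ b)) (⊓-comm d c) (⊔-comm d c)
      (insideOutside (a ⊓ b) (a ⊔ b) d c (≢min ca cb) (≢max ca cb) p q (λ (x , y) → c-out (min<max⇒btw a b c x y)))

module ListFacts where

  open import Data.Bool.ListAction using (all; any)
  open import Data.List.Membership.Propositional.Properties using (∈-upTo⁺)

  module _ {A : Set} where

    all-sound : ∀ (p : A → Bool) xs → all p xs ≡ true → ∀ {x} → x ∈ xs → p x ≡ true
    all-sound p (y ∷ ys) e (here refl) with p y | e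
    ... | true | _ = refl
    all-sound p (y ∷ ys) e (there x∈) with p y | e
    ... | true | e' = all-sound p ys e' x∈

    any-sound : ∀ (p : A → Bool) xs → any p xs ≡ true → ∃ λ x → (x ∈ xs) × (p x ≡ true)
    any-sound p (y ∷ ys) e with p y in eq
    ... | true = y , here refl , eq
    ... | false with any-sound p ys e
    ...   | x , x∈ , px = x , there x∈ , px

  all-below : ∀ n (p : ℕ → Bool) → all p (Data.List.upTo n) ≡ true → ∀ i → i < n → p i ≡ true
  all-below n p e i i<n = all-sound p (Data.List.upTo n) e (∈-upTo⁺ i<n)

  sumBelow : ℕ → (ℕ → ℕ) → ℕ
  sumBelow zero f = 0
  sumBelow (suc n) f = sumBelow n f + f n

-- The periodic colouring.  pat t j is the colour of the point j positions
-- after a point at pattern phase t.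
module Pattern where

  open import Defs using (pattern16)
  open import Data.Nat.DivMod
  open import Data.Nat.Divisibility using (_∣_)

  pat : ℕ → ℕ → Bool
  pat t j = pattern16 ((t + j) % 16)

  %16-absorbˡ : ∀ m i → (m % 16 + i) % 16 ≡ (m + i) % 16
  %16-absorbˡ m i = begin
    (m % 16 + i) % 16              ≡⟨ %-distribˡ-+ (m % 16) i 16 ⟩
    (m % 16 % 16 + i % 16) % 16    ≡⟨ cong (λ z → (z + i % 16) % 16) (m%n%n≡m%n m 16) ⟩
    (m % 16 + i % 16) % 16         ≡⟨ %-distribˡ-+ m i 16 ⟨
    (m + i) % 16 ∎
    where open ≡-Reasoning

  pat-shift : ∀ t lo i → pat t (lo + i) ≡ pat ((t + lo) % 16) (0 + i)
  pat-shift t lo i = cong pattern16 (trans (cong (_% 16) (sym (+-assoc t lo i))) (sym (%16-absorbˡ (t + lo) i)))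

  pat-mod : ∀ t nn .{{_ : NonZero nn}} → 16 ∣ nn → ∀ m → pat t (m % nn) ≡ pat t m
  pat-mod t nn 16∣nn m = cong pattern16 (begin
    (t + m % nn) % 16               ≡⟨ %-distribˡ-+ t (m % nn) 16 ⟩
    (t % 16 + m % nn % 16) % 16     ≡⟨ cong (λ z → (t % 16 + z) % 16) (m∣n⇒o%n%m≡o%m 16 nn m 16∣nn) ⟩
    (t % 16 + m % 16) % 16          ≡⟨ %-distribˡ-+ t m 16 ⟨
    (t + m) % 16 ∎)
    where open ≡-Reasoning

-- Grow C a m c: the interval [a, a + m) can be built from one point by
-- repeatedly adding a point at one of its ends, the colours of the added
-- points alternating, the last added point having colour c.  (Read
-- backwards, the removed points of a Peel form a Grow.)
module Windows where

  open Chords using (Peel; pdone; pleft; pright)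
  open BoolFacts
  open ListFacts
  open Pattern
  open import Data.Nat using (_≡ᵇ_)
  open import Data.Nat.DivMod using (m%n<n)
  open import Data.Bool.ListAction using (all)
  open import Data.Bool.Properties using (¬-not)

  data Grow (C : ℕ → Bool) : ℕ → ℕ → Bool → Set where
    gstart : ∀ {a} → Grow C a 1 (C a)
    gaddL : ∀ {a m c} → Grow C (suc a) m c → C a ≢ c → Grow C a (suc m) (C a)
    gaddR : ∀ {a m c} → Grow C a m c → C (a + m) ≢ c → Grow C a (suc m) (C (a + m))

  -- boolean searches for a Peel and a Grow; only their completeness is needed,
  -- to refute peels and grows by computation
  peelB : (ℕ → Bool) → ℕ → ℕ → Bool → Bool
  peelB C lo zero c = true
  peelB C lo (suc len) c =
    ((C lo xor c) ∧ peelB C (suc lo) len (C lo)) ∨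
    ((C (lo + len) xor c) ∧ peelB C lo len (C (lo + len)))

  growB : (ℕ → Bool) → ℕ → ℕ → Bool → Bool
  growB C a zero c = false
  growB C a (suc m) c =
    ((m ≡ᵇ 0) ∧ not (C a xor c)) ∨
    ((not (C a xor c) ∧ growB C (suc a) m (not c)) ∨
     (not (C (a + m) xor c) ∧ growB C a m (not c)))

  peelB-complete : ∀ {C lo len c} → Peel C lo len c → peelB C lo len c ≡ true
  peelB-complete pdone = refl
  peelB-complete (pleft ne p) = ∨-introˡ _ (∧-intro (xor-≢ ne) (peelB-complete p))
  peelB-complete (pright ne p) = ∨-introʳ _ (∧-intro (xor-≢ ne) (peelB-complete p))

  growB-complete : ∀ {C a m c} → Grow C a m c → growB C a m c ≡ true
  growB-complete {C} {a} gstart = ∨-introˡ _ (not-xor-self (C a))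
  growB-complete {C} {a} {suc m} (gaddL g ne) =
    ∨-introʳ ((m ≡ᵇ 0) ∧ not (C a xor C a)) (∨-introˡ _ (∧-intro (not-xor-self (C a))
      (subst (λ c' → growB C (suc a) m c' ≡ true) (¬-not (λ e → ne (sym e))) (growB-complete g))))
  growB-complete {C} {a} {suc m} (gaddR g ne) =
    ∨-introʳ ((m ≡ᵇ 0) ∧ not (C a xor C (a + m)))
      (∨-introʳ (not (C a xor C (a + m)) ∧ growB C (suc a) m (not (C (a + m))))
        (∧-intro (not-xor-self (C (a + m)))
      (subst (λ c' → growB C a m c' ≡ true) (¬-not (λ e → ne (sym e))) (growB-complete g))))

  peel-transfer : ∀ {C C' lo lo' len c} → Peel C lo len c →
    (∀ i → i < len → C (lo + i) ≡ C' (lo' + i)) → Peel C' lo' len c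
  peel-transfer pdone agree = pdone
  peel-transfer {C} {C'} {lo} {lo'} {suc len} (pleft ne p) agree =
    pleft (λ e → ne (trans first e))
      (subst (Peel C' (suc lo') len) first
        (peel-transfer p (λ i i< → trans (cong C (sym (+-suc lo i))) (trans (agree (suc i) (s≤s i<)) (cong C' (+-suc lo' i))))))
    where
    first : C lo ≡ C' lo'
    first = trans (sym (cong C (+-identityʳ lo))) (trans (agree 0 z<s) (cong C' (+-identityʳ lo')))
  peel-transfer {C} {C'} {lo} {lo'} {suc len} (pright ne p) agree =
    pright (λ e → ne (trans (agree len ≤-refl) e))
      (subst (Peel C' lo' len) (agree len ≤-refl) (peel-transfer p (λ i i< → agree i (m<n⇒m<1+n i<))))

  grow-transfer : ∀ {C C' a a' m c} → Grow C a m c →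
    (∀ i → i < m → C (a + i) ≡ C' (a' + i)) → Grow C' a' m c
  grow-transfer {C} {C'} {a} {a'} gstart agree =
    subst (Grow C' a' 1) (sym first) gstart
    where
    first : C a ≡ C' a'
    first = trans (sym (cong C (+-identityʳ a))) (trans (agree 0 z<s) (cong C' (+-identityʳ a')))
  grow-transfer {C} {C'} {a} {a'} {suc m} (gaddL g ne) agree =
    subst (Grow C' a' (suc m)) (sym first)
      (gaddL (grow-transfer g (λ i i< → trans (cong C (sym (+-suc a i))) (trans (agree (suc i) (s≤s i<)) (cong C' (+-suc a' i)))))
             (λ e → ne (trans first e)))
    where
    first : C a ≡ C' a'
    first = trans (sym (cong C (+-identityʳ a))) (trans (agree 0 z<s) (cong C' (+-identityʳ a')))
  grow-transfer {C} {C'} {a} {a'} {suc m} (gaddR g ne) agree =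
    subst (Grow C' a' (suc m)) (sym (agree m ≤-refl))
      (gaddR (grow-transfer g (λ i i< → agree i (m<n⇒m<1+n i<))) (λ e → ne (trans (agree m ≤-refl) e)))

  peel-shrink : ∀ {C lo len c} → Peel C lo len c → 10 ≤ len → Σ ℕ λ lo' → Σ Bool λ c' → Peel C lo' 10 c'
  peel-shrink {len = len} p le with len ≟ 10
  peel-shrink {lo = lo} {c = c} p le | yes refl = lo , c , p
  peel-shrink (pleft _ p) le | no ne = peel-shrink p (≤-pred (≤∧≢⇒< le (λ e → ne (sym e))))
  peel-shrink (pright _ p) le | no ne = peel-shrink p (≤-pred (≤∧≢⇒< le (λ e → ne (sym e))))

  grow-shrink : ∀ {C a m c} → Grow C a m c → 10 ≤ m → Σ ℕ λ a' → Σ Bool λ c' → Grow C a' 10 c'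
  grow-shrink {m = m} g le with m ≟ 10
  grow-shrink {a = a} {c = c} g le | yes refl = a , c , g
  grow-shrink gstart (s≤s ()) | no _
  grow-shrink (gaddL g _) le | no ne = grow-shrink g (≤-pred (≤∧≢⇒< le (λ e → ne (sym e))))
  grow-shrink (gaddR g _) le | no ne = grow-shrink g (≤-pred (≤∧≢⇒< le (λ e → ne (sym e))))

  bothColours : ∀ c → c ∈ true ∷ false ∷ []
  bothColours true = here refl
  bothColours false = there (here refl)

  stuck10 : ℕ → Bool → Bool
  stuck10 t c = not (peelB (pat t) 0 10 c) ∧ not (growB (pat t) 0 10 c)

  allStuck10 : all (λ t → all (stuck10 t) (true ∷ false ∷ [])) (Data.List.upTo 16) ≡ true
  allStuck10 = refl

  stuck10At : ∀ t c → t < 16 → stuck10 t c ≡ true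
  stuck10At t c t<16 =
    all-sound (stuck10 t) (true ∷ false ∷ []) (all-below 16 (λ t → all (stuck10 t) (true ∷ false ∷ [])) allStuck10 t t<16)
      (bothColours c)

  noPeel10 : ∀ t c → t < 16 → peelB (pat t) 0 10 c ≢ true
  noPeel10 t c t<16 = not-true⇒¬ (∧-true₁ (stuck10At t c t<16))

  noGrow10 : ∀ t c → t < 16 → growB (pat t) 0 10 c ≢ true
  noGrow10 t c t<16 = not-true⇒¬ (∧-true₂ {not (peelB (pat t) 0 10 c)} (stuck10At t c t<16))

  noLongPeel : ∀ t lo len c → Peel (pat t) lo len c → 10 ≤ len → ⊥
  noLongPeel t lo len c p le with peel-shrink p le
  ... | lo' , c' , p' =
    noPeel10 ((t + lo') % 16) c' (m%n<n (t + lo') 16)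
      (peelB-complete (peel-transfer {C' = pat ((t + lo') % 16)} {lo' = 0} p' (λ i _ → pat-shift t lo' i)))

  noLongGrow : ∀ t a m c → Grow (pat t) a m c → 10 ≤ m → ⊥
  noLongGrow t a m c g le with grow-shrink g le
  ... | a' , c' , g' =
    noGrow10 ((t + a') % 16) c' (m%n<n (t + a') 16)
      (growB-complete (grow-transfer {C' = pat ((t + a') % 16)} {a' = 0} g' (λ i _ → pat-shift t a' i)))

-- A base of length L = σ + p + 1, read in path order.  The first vertex of
-- the path sits at pattern position p of the base; cutting the base just
-- after it and relabelling, the remaining positions 0 … σ + p - 1 carry the
-- pattern positions p + 1 … L - 1 followed by 0 … p - 1.  This relabelled
-- colouring is rotColour.  It is not a window of the pattern: the seam
-- between σ - 1 and σ joins pattern positions L - 1 and 0.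
module SplitWindow (t σ p : ℕ) where

  open Chords using (Peel; pdone; pleft; pright)
  open Pattern
  open Windows
  open import Data.Nat.DivMod
  open import Data.Nat.Tactic.RingSolver using (solve-∀)

  L : ℕ
  L = suc (σ + p)

  rotColour : ℕ → Bool
  rotColour q = pat t ((q + suc p) % L)

  rotColour-low : ∀ q → q < σ → rotColour q ≡ pat t (q + suc p)
  rotColour-low q q<σ = cong (pat t) (m<n⇒m%n≡m (subst (q + suc p <_) (+-suc σ p) (+-monoˡ-< (suc p) q<σ)))

  rotColour-high : ∀ r → r < L → rotColour (σ + r) ≡ pat t r
  rotColour-high r r<L = cong (pat t) (trans (cong (_% L) (shift σ r p)) (trans ([m+n]%n≡m%n r L) (m<n⇒m%n≡m r<L)))
    where
    shift : ∀ σ r p → σ + r + suc p ≡ r + suc (σ + p)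
    shift = solve-∀

  peelHigh : ∀ {len c} → Peel rotColour σ len c → len ≤ L → Peel (pat t) 0 len c
  peelHigh pe le = peel-transfer pe (λ i i< → rotColour-high i (<-≤-trans i< le))

  peelLow : ∀ {lo len c} → Peel rotColour lo len c → lo + len ≤ σ → Peel (pat t) (lo + suc p) len c
  peelLow {lo} pe le =
    peel-transfer pe (λ i i< → trans (rotColour-low (lo + i) (<-≤-trans (+-monoʳ-< lo i<) le)) (cong (pat t) (shift lo i p)))
    where
    shift : ∀ lo i p → lo + i + suc p ≡ (lo + suc p) + i
    shift = solve-∀

  module _ (long : 19 ≤ σ + p) where

    -- a peel and a grow of the pattern whose lengths add up to L ≥ 20
    -- cannot both exist: one of them has length at least 10
    peelAndGrow : ∀ {lo len c a m c'} → Peel (pat t) lo len c → Grow (pat t) a m c' → m + len ≡ L → ⊥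
    peelAndGrow {lo} {len} {c} {a} {m} {c'} pe g m+len≡L with 10 ≤? len | 10 ≤? m
    ... | yes 10≤len | _ = noLongPeel t lo len c pe 10≤len
    ... | no _ | yes 10≤m = noLongGrow t a m c' g 10≤m
    ... | no len<10 | no m<10 =
      ≤⇒≯ (≤-trans (≤-reflexive (sym m+len≡L)) (+-mono-≤ (≤-pred (≰⇒> m<10)) (≤-pred (≰⇒> len<10))))
          (s≤s (≤-trans (n≤1+n 18) long))

    -- Invariant while the peel [lo, lo + len) of rotColour straddles the seam
    -- (lo < σ < lo + len): the points removed so far form a grow [a, a + m)
    -- of the pattern ending with the colour c of the last removed point, with
    -- a + σ = lo + len and m + len = L.  Once the peel stops straddling, what
    -- remains is a peel of the pattern, contradicting peelAndGrow.
    straddle : ∀ {lo len c a m} → Peel rotColour lo len c → Grow (pat t) a m c → lo < σ → σ < lo + len →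
               a + σ ≡ lo + len → m + len ≡ L → lo + len ≤ σ + p → ⊥
    straddle {lo} pdone g lo<σ σ<end _ _ _ = <-asym lo<σ (subst (σ <_) (+-identityʳ lo) σ<end)
    straddle {lo} {suc len} {_} {a} {m} (pleft ne rest) g lo<σ σ<end a+σ≡ m+len≡ end≤ = continue (suc lo <? σ)
      where
      a+m≡ : a + m ≡ lo + suc p
      a+m≡ = +-cancelʳ-≡ (σ + suc len) _ _ (trans (sym (rearrange₁ a m σ (suc len)))
               (trans (cong₂ _+_ a+σ≡ m+len≡) (rearrange₂ lo len σ p)))
        where
        rearrange₁ : ∀ a m σ len → (a + σ) + (m + len) ≡ (a + m) + (σ + len)
        rearrange₁ = solve-∀
        rearrange₂ : ∀ lo len σ p → lo + suc len + suc (σ + p) ≡ (lo + suc p) + (σ + suc len)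
        rearrange₂ = solve-∀
      removed : rotColour lo ≡ pat t (a + m)
      removed = trans (rotColour-low lo lo<σ) (cong (pat t) (sym a+m≡))
      grown : Grow (pat t) a (suc m) (rotColour lo)
      grown = subst (Grow (pat t) a (suc m)) (sym removed) (gaddR g (λ e → ne (trans removed e)))
      lengths : suc m + len ≡ L
      lengths = trans (sym (+-suc m len)) m+len≡
      continue : Dec (suc lo < σ) → ⊥
      continue (yes lo+1<σ) =
        straddle rest grown lo+1<σ (subst (σ <_) (+-suc lo len) σ<end) (trans a+σ≡ (+-suc lo len)) lengths
          (subst (_≤ σ + p) (+-suc lo len) end≤)
      continue (no lo+1≮σ) with ≤-antisym lo<σ (≮⇒≥ lo+1≮σ)
      ... | refl = peelAndGrow (peelHigh rest (subst (_≤ L) (+-identityˡ len) (≤-trans (m≤n+m len (suc m)) (≤-reflexive lengths))))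
                     grown lengths
    straddle {lo} {suc len} {c} {a} {m} (pright ne rest) g lo<σ σ<end a+σ≡ m+len≡ end≤
      with m≤n⇒∃[o]m+o≡n (≤-pred (subst (σ <_) (+-suc lo len) σ<end))
    ... | r , σ+r≡ = continue (σ <? lo + len)
      where
      a≡ : a ≡ suc r
      a≡ = +-cancelʳ-≡ σ a (suc r) (trans a+σ≡ (trans (+-suc lo len) (trans (cong suc (sym σ+r≡)) (cong suc (+-comm σ r)))))
      r<p : r < p
      r<p = +-cancelˡ-< σ r p (≤-trans (≤-reflexive (trans (cong suc σ+r≡) (sym (+-suc lo len)))) end≤)
      removed : rotColour (lo + len) ≡ pat t r
      removed = trans (cong rotColour (sym σ+r≡)) (rotColour-high r (<-trans r<p (s≤s (m≤n+m p σ))))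
      grown : Grow (pat t) r (suc m) (rotColour (lo + len))
      grown = subst (Grow (pat t) r (suc m)) (sym removed)
                (gaddL (subst (λ z → Grow (pat t) z m c) a≡ g) (λ e → ne (trans removed e)))
      lengths : suc m + len ≡ L
      lengths = trans (sym (+-suc m len)) m+len≡
      continue : Dec (σ < lo + len) → ⊥
      continue (yes σ<end') = straddle rest grown lo<σ σ<end' (trans (+-comm r σ) σ+r≡) lengths
                                (≤-trans (+-monoʳ-≤ lo (n≤1+n len)) end≤)
      continue (no σ≮end') = peelAndGrow (peelLow rest (≮⇒≥ σ≮end')) grown lengths

    noLongSplitPeel : Peel rotColour 0 (σ + p) (rotColour (σ + p)) → ⊥
    noLongSplitPeel pe with σ ≟ 0 | p ≟ 0
    ... | yes refl | _ = noLongPeel t 0 p _ (peelHigh pe (n≤1+n p)) (≤-trans (m≤n+m 10 9) long)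
    ... | no _ | yes refl =
      noLongPeel t 1 (σ + 0) _ (peelLow pe (≤-reflexive (+-identityʳ σ))) (≤-trans (m≤n+m 10 9) long)
    ... | no σ≢0 | no p≢0 =
      straddle pe (subst (Grow (pat t) p 1) (sym (rotColour-high p (s≤s (m≤n+m p σ)))) gstart)
        (n≢0⇒n>0 σ≢0) (m<m+n σ (n≢0⇒n>0 p≢0)) (+-comm p σ) refl ≤-refl

-- An upper bound, computable from the pattern alone, for twice the weight
-- of a path whose vertices lie in a window of L consecutive points.  Each
-- run meeting the window is charged to the window position where it starts,
-- or to position 0 if it starts before the window: 2 if it lies inside the
-- window, otherwise 1.
module WindowWeight where

  open Pattern
  open ListFacts using (sumBelow)
  open BoolFacts
  open import Data.Nat using (_≡ᵇ_)

  runStart : ℕ → ℕ → Bool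
  runStart t j = pat t (j + 15) xor pat t j

  runEnd : ℕ → ℕ → ℕ → ℕ → ℕ
  runEnd zero t j e = e
  runEnd (suc fuel) t j e = if pat t (j + e) xor pat t j then e else runEnd fuel t j (suc e)

  -- length of the pattern run starting at j (runs are shorter than 16)
  runLength : ℕ → ℕ → ℕ
  runLength t j = runEnd 16 t j 1

  runEnd-≤ : ∀ fuel t j e ℓ → e ≤ ℓ → ℓ ≤ e + fuel → pat t (j + ℓ) ≢ pat t j → runEnd fuel t j e ≤ ℓ
  runEnd-≤ zero t j e ℓ e≤ℓ _ _ = e≤ℓ
  runEnd-≤ (suc fuel) t j e ℓ e≤ℓ ℓ≤ changes with pat t (j + e) xor pat t j in same
  ... | true = e≤ℓ
  ... | false = runEnd-≤ fuel t j (suc e) ℓ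
                  (≤∧≢⇒< e≤ℓ (λ e≡ℓ → changes (subst (λ z → pat t (j + z) ≡ pat t j) e≡ℓ (xor-false⇒≡ same))))
                  (subst (ℓ ≤_) (+-suc e fuel) ℓ≤) changes

  positionWeight : ℕ → ℕ → ℕ → ℕ
  positionWeight t L j =
    if runStart t j then (if j + runLength t j ≤ᵇ L then 2 else 1) else (if j ≡ᵇ 0 then 1 else 0)

  windowWeight : ℕ → ℕ → ℕ
  windowWeight t L = sumBelow L (positionWeight t L)

  two-or-one : ∀ (c : Bool) → 1 ≤ (if c then 2 else 1)
  two-or-one true = s≤s z≤n
  two-or-one false = s≤s z≤n

  positionWeight-start : ∀ t L j → runStart t j ≡ true → 1 ≤ positionWeight t L j
  positionWeight-start t L j start =
    subst (λ r → 1 ≤ (if r then (if j + runLength t j ≤ᵇ L then 2 else 1) else (if j ≡ᵇ 0 then 1 else 0)))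
      (sym start) (two-or-one (j + runLength t j ≤ᵇ L))

  positionWeight-0 : ∀ t L → 1 ≤ positionWeight t L 0
  positionWeight-0 t L = helper (runStart t 0)
    where
    helper : ∀ r → 1 ≤ (if r then (if 0 + runLength t 0 ≤ᵇ L then 2 else 1) else 1)
    helper true = two-or-one _
    helper false = s≤s z≤n

  positionWeight-inside : ∀ t L j → runStart t j ≡ true → j + runLength t j ≤ L → positionWeight t L j ≡ 2
  positionWeight-inside t L j start fits =
    subst (λ r → (if r then (if j + runLength t j ≤ᵇ L then 2 else 1) else (if j ≡ᵇ 0 then 1 else 0)) ≡ 2) (sym start)
      (subst (λ f → (if f then 2 else 1) ≡ 2) (sym (T⇒≡true (≤⇒≤ᵇ fits))) refl)

-- Finite check of all bases of length at most 19: whenever the rest of the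
-- path can peel the split base, the base has at most 15 points and its window
-- weight is at most 7.  Together with noLongSplitPeel this covers all bases.
module PeelableBases where

  open Chords using (Peel)
  open BoolFacts
  open ListFacts
  open Windows using (peelB; peelB-complete)
  open WindowWeight using (windowWeight)
  open SplitWindow using (rotColour; noLongSplitPeel)
  open import Data.Bool.ListAction using (all)

  -- the claim for one base (σ, p) and phase t; bases with σ + p ≥ 19 are
  -- handled by noLongSplitPeel
  acceptable : ℕ → ℕ → ℕ → Bool
  acceptable σ p t =
    (19 ≤ᵇ σ + p) ∨
    (not (peelB (rotColour t σ p) 0 (σ + p) (rotColour t σ p (σ + p))) ∨
     ((σ + p <ᵇ 15) ∧ (windowWeight t (suc (σ + p)) ≤ᵇ 7)))

  allAcceptable : all (λ σ → all (λ p → all (acceptable σ p) (Data.List.upTo 16)) (Data.List.upTo 19))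
                      (Data.List.upTo 19) ≡ true
  allAcceptable = refl

  peelableBase : ∀ t σ p → t < 16 → Peel (rotColour t σ p) 0 (σ + p) (rotColour t σ p (σ + p)) →
    (σ + p < 15) × (windowWeight t (suc (σ + p)) ≤ 7)
  peelableBase t σ p t<16 pe with 19 ≤? σ + p
  ... | yes long = ⊥-elim (noLongSplitPeel t σ p long pe)
  ... | no short = <ᵇ⇒< _ _ (≡true⇒T (∧-true₁ small)) , ≤ᵇ⇒≤ _ 7 (≡true⇒T (∧-true₂ {σ + p <ᵇ 15} small))
    where
    σ<19 : σ < 19
    σ<19 = ≤-<-trans (m≤m+n σ p) (≰⇒> short)
    p<19 : p < 19
    p<19 = ≤-<-trans (m≤n+m p σ) (≰⇒> short)
    checked : acceptable σ p t ≡ true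
    checked = all-below 16 (acceptable σ p)
                (all-below 19 (λ p → all (acceptable σ p) (Data.List.upTo 16))
                  (all-below 19 (λ σ → all (λ p → all (acceptable σ p) (Data.List.upTo 16)) (Data.List.upTo 19))
                    allAcceptable σ σ<19) p p<19) t t<16
    peels : not (peelB (rotColour t σ p) 0 (σ + p) (rotColour t σ p (σ + p))) ≢ true
    peels e with trans (cong not (sym (peelB-complete pe))) e
    ... | ()
    small : ((σ + p <ᵇ 15) ∧ (windowWeight t (suc (σ + p)) ≤ᵇ 7)) ≡ true
    small = ∨-resolve (∨-resolve checked (λ e → short (≤ᵇ⇒≤ 19 (σ + p) (≡true⇒T e)))) peels

module Circle (k : ℕ) where

  open import Defs using (N; pt; interval; _⊆_)
  import Data.Fin.Properties as FinP
  open import Data.Nat.DivMod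
  open import Data.Nat.Divisibility using (_∣_; divides)
  open import Data.List.Membership.Propositional.Properties using (∈-map⁺; ∈-map⁻; ∈-upTo⁺; ∈-upTo⁻)

  n : ℕ
  n = N k

  16∣n : 16 ∣ n
  16∣n = divides (suc k) (*-comm 16 (suc k))

  n≡16+k*16 : n ≡ 16 + k * 16
  n≡16+k*16 = trans (*-suc 16 k) (cong (16 +_) (*-comm 16 k))

  %-absorbʳ : ∀ a m → (a + m % n) % n ≡ (a + m) % n
  %-absorbʳ a m = begin
    (a + m % n) % n             ≡⟨ %-distribˡ-+ a (m % n) n ⟩
    (a % n + m % n % n) % n     ≡⟨ cong (λ z → (a % n + z) % n) (m%n%n≡m%n m n) ⟩
    (a % n + m % n) % n         ≡⟨ %-distribˡ-+ a m n ⟨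
    (a + m) % n ∎
    where open ≡-Reasoning

  %-absorbˡ : ∀ a m → (m % n + a) % n ≡ (m + a) % n
  %-absorbˡ a m = trans (cong (_% n) (+-comm (m % n) a)) (trans (%-absorbʳ a m) (cong (_% n) (+-comm a m)))

  toℕ-pt : ∀ m → toℕ (pt k m) ≡ m % n
  toℕ-pt m = FinP.toℕ-fromℕ< (m%n<n m n)

  pt-cong : ∀ m m' → m % n ≡ m' % n → pt k m ≡ pt k m'
  pt-cong m m' e = FinP.toℕ-injective (trans (toℕ-pt m) (trans e (sym (toℕ-pt m'))))

  pt-toℕ : ∀ (z : Fin n) → pt k (toℕ z) ≡ z
  pt-toℕ z = FinP.toℕ-injective (trans (toℕ-pt (toℕ z)) (m<n⇒m%n≡m (FinP.toℕ<n z)))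

  pt-+0 : ∀ (z : Fin n) → pt k (toℕ z + 0) ≡ z
  pt-+0 z = trans (cong (pt k) (+-identityʳ (toℕ z))) (pt-toℕ z)

  pt-pt : ∀ m j → pt k (toℕ (pt k m) + j) ≡ pt k (m + j)
  pt-pt m j = pt-cong (toℕ (pt k m) + j) (m + j) (trans (cong (λ z → (z + j) % n) (toℕ-pt m)) (%-absorbˡ j m))

  pt-+n : ∀ m → pt k (m + n) ≡ pt k m
  pt-+n m = pt-cong (m + n) m ([m+n]%n≡m%n m n)

  offset : Fin n → Fin n → ℕ
  offset c z = (toℕ z + (n ∸ toℕ c)) % n

  offset<n : ∀ c z → offset c z < n
  offset<n c z = m%n<n (toℕ z + (n ∸ toℕ c)) n

  toℕ≤n : ∀ (c : Fin n) → toℕ c ≤ n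
  toℕ≤n c = <⇒≤ (FinP.toℕ<n c)

  around : ∀ (c : Fin n) m → (toℕ c + (n ∸ toℕ c) + m) % n ≡ m % n
  around c m = begin
    (toℕ c + (n ∸ toℕ c) + m) % n   ≡⟨ cong (λ z → (z + m) % n) (m+[n∸m]≡n (toℕ≤n c)) ⟩
    (n + m) % n                     ≡⟨ cong (_% n) (+-comm n m) ⟩
    (m + n) % n                     ≡⟨ [m+n]%n≡m%n m n ⟩
    m % n ∎
    where open ≡-Reasoning

  offset-pt : ∀ c j → offset c (pt k (toℕ c + j)) ≡ j % n
  offset-pt c j = begin
    (toℕ (pt k (toℕ c + j)) + (n ∸ toℕ c)) % n  ≡⟨ cong (λ z → (z + (n ∸ toℕ c)) % n) (toℕ-pt (toℕ c + j)) ⟩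
    ((toℕ c + j) % n + (n ∸ toℕ c)) % n         ≡⟨ %-absorbˡ (n ∸ toℕ c) (toℕ c + j) ⟩
    (toℕ c + j + (n ∸ toℕ c)) % n               ≡⟨ cong (_% n) (+-exchange (toℕ c) j (n ∸ toℕ c)) ⟩
    (toℕ c + (n ∸ toℕ c) + j) % n               ≡⟨ around c j ⟩
    j % n ∎
    where
    open ≡-Reasoning
    +-exchange : ∀ a b c → a + b + c ≡ a + c + b
    +-exchange a b c = trans (+-assoc a b c) (trans (cong (a +_) (+-comm b c)) (sym (+-assoc a c b)))

  pt-offset : ∀ c z → pt k (toℕ c + offset c z) ≡ z
  pt-offset c z = trans (pt-cong (toℕ c + offset c z) (toℕ z) (begin
    (toℕ c + offset c z) % n             ≡⟨ %-absorbʳ (toℕ c) _ ⟩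
    (toℕ c + (toℕ z + (n ∸ toℕ c))) % n  ≡⟨ cong (λ w → (toℕ c + w) % n) (+-comm (toℕ z) _) ⟩
    (toℕ c + ((n ∸ toℕ c) + toℕ z)) % n  ≡⟨ cong (_% n) (+-assoc (toℕ c) _ (toℕ z)) ⟨
    (toℕ c + (n ∸ toℕ c) + toℕ z) % n    ≡⟨ around c (toℕ z) ⟩
    toℕ z % n ∎)) (pt-toℕ z)
    where open ≡-Reasoning

  offset-inj : ∀ c {z w} → offset c z ≡ offset c w → z ≡ w
  offset-inj c {z} {w} e = trans (sym (pt-offset c z)) (trans (cong (λ u → pt k (toℕ c + u)) e) (pt-offset c w))

  offset-shift : ∀ c w i → offset c (pt k (toℕ w + i)) ≡ (offset c w + i) % n
  offset-shift c w i = begin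
    offset c (pt k (toℕ w + i))                          ≡⟨ cong (λ u → offset c (pt k (toℕ u + i))) (sym (pt-offset c w)) ⟩
    offset c (pt k (toℕ (pt k (toℕ c + offset c w)) + i)) ≡⟨ cong (offset c) (pt-pt (toℕ c + offset c w) i) ⟩
    offset c (pt k (toℕ c + offset c w + i))             ≡⟨ cong (λ u → offset c (pt k u)) (+-assoc (toℕ c) _ i) ⟩
    offset c (pt k (toℕ c + (offset c w + i)))           ≡⟨ offset-pt c _ ⟩
    (offset c w + i) % n ∎
    where open ≡-Reasoning

  offset-self : ∀ c → offset c c ≡ 0
  offset-self c = trans (cong (offset c) (sym (pt-+0 c))) (offset-pt c 0)

  ∈interval : ∀ c ℓ j → j < ℓ → pt k (toℕ c + j) ∈ interval k c ℓ
  ∈interval c ℓ j j<ℓ = ∈-map⁺ (λ j → pt k (toℕ c + j)) (∈-upTo⁺ j<ℓ)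

  ∈interval⁻ : ∀ c ℓ z → z ∈ interval k c ℓ → ∃ λ j → (j < ℓ) × (z ≡ pt k (toℕ c + j))
  ∈interval⁻ c ℓ z z∈ with ∈-map⁻ (λ j → pt k (toℕ c + j)) z∈
  ... | j , j∈ , e = j , ∈-upTo⁻ j∈ , e

  ∈interval⇒offset< : ∀ c ℓ z → ℓ ≤ n → z ∈ interval k c ℓ → offset c z < ℓ
  ∈interval⇒offset< c ℓ z ℓ≤n z∈ with ∈interval⁻ c ℓ z z∈
  ... | j , j<ℓ , refl = subst (_< ℓ) (sym (trans (offset-pt c j) (m<n⇒m%n≡m (<-≤-trans j<ℓ ℓ≤n)))) j<ℓ

  offset<⇒∈interval : ∀ c ℓ z → offset c z < ℓ → z ∈ interval k c ℓ
  offset<⇒∈interval c ℓ z lt = subst (_∈ interval k c ℓ) (pt-offset c z) (∈interval c ℓ (offset c z) lt)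

  pt-cancel : ∀ a b i → pt k (a + i) ≡ pt k (b + i) → pt k a ≡ pt k b
  pt-cancel a b i e = pt-cong a b (begin
    a % n                          ≡⟨ back a ⟨
    (a + i + (n ∸ 1) * i) % n      ≡⟨ %-absorbˡ ((n ∸ 1) * i) (a + i) ⟨
    ((a + i) % n + (n ∸ 1) * i) % n ≡⟨ cong (λ z → (z + (n ∸ 1) * i) % n)
                                          (trans (sym (toℕ-pt (a + i))) (trans (cong toℕ e) (toℕ-pt (b + i)))) ⟩
    ((b + i) % n + (n ∸ 1) * i) % n ≡⟨ %-absorbˡ ((n ∸ 1) * i) (b + i) ⟩
    (b + i + (n ∸ 1) * i) % n      ≡⟨ back b ⟩
    b % n ∎)
    where
    open ≡-Reasoning
    -- i + (n - 1) i = n i is a multiple of n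
    back : ∀ c → (c + i + (n ∸ 1) * i) % n ≡ c % n
    back c = trans (cong (_% n) (trans (+-assoc c i _) (cong (c +_) (*-comm n i)))) ([m+kn]%n≡m%n c i n)

  startInside : ∀ (s₁ s₂ : Fin n) i₁ i₂ → i₁ ≤ i₂ → pt k (toℕ s₁ + i₁) ≡ pt k (toℕ s₂ + i₂) →
    s₁ ≡ pt k (toℕ s₂ + (i₂ ∸ i₁))
  startInside s₁ s₂ i₁ i₂ i₁≤i₂ meet =
    trans (sym (pt-toℕ s₁)) (pt-cancel (toℕ s₁) (toℕ s₂ + (i₂ ∸ i₁)) i₁ (trans meet (cong (pt k) shift)))
    where
    shift : toℕ s₂ + i₂ ≡ toℕ s₂ + (i₂ ∸ i₁) + i₁
    shift = trans (cong (toℕ s₂ +_) (sym (m∸n+n≡m i₁≤i₂))) (sym (+-assoc (toℕ s₂) (i₂ ∸ i₁) i₁))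

  reindex : ∀ (s' s'' : Fin n) i₀ → pt k (toℕ s'' + i₀) ≡ s' → ∀ d → pt k (toℕ s'' + (i₀ + d)) ≡ pt k (toℕ s' + d)
  reindex s' s'' i₀ at d = begin
    pt k (toℕ s'' + (i₀ + d))          ≡⟨ cong (pt k) (+-assoc (toℕ s'') i₀ d) ⟨
    pt k (toℕ s'' + i₀ + d)            ≡⟨ pt-pt (toℕ s'' + i₀) d ⟨
    pt k (toℕ (pt k (toℕ s'' + i₀)) + d) ≡⟨ cong (λ z → pt k (toℕ z + d)) at ⟩
    pt k (toℕ s' + d) ∎
    where open ≡-Reasoning

  neighboursOutside⇒maximal : ∀ (P : List (Fin n)) s ℓ → 1 ≤ ℓ → ℓ < n →
    ¬ (pt k (toℕ s + (n ∸ 1)) ∈ P) → ¬ (pt k (toℕ s + ℓ) ∈ P) →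
    ∀ s'' ℓ'' → _⊆_ k (interval k s'' ℓ'') P → _⊆_ k (interval k s ℓ) (interval k s'' ℓ'') →
    _⊆_ k (interval k s'' ℓ'') (interval k s ℓ)
  neighboursOutside⇒maximal P s ℓ 1≤ℓ ℓ<n before after s'' ℓ'' J⊆P I⊆J {y} y∈J
    with ∈interval⁻ s'' ℓ'' s (I⊆J (subst (_∈ interval k s ℓ) (pt-+0 s) (∈interval s ℓ 0 1≤ℓ)))
       | ∈interval⁻ s'' ℓ'' y y∈J
  ... | i₀ , i₀<ℓ'' , s≡ | i , i<ℓ'' , refl with i₀ ≤? i
  ...   | yes i₀≤i = inside (i ∸ i₀ <? ℓ)
    where
    at : pt k (toℕ s'' + i₀) ≡ s
    at = sym s≡
    atI : pt k (toℕ s'' + i) ≡ pt k (toℕ s + (i ∸ i₀))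
    atI = trans (cong (λ u → pt k (toℕ s'' + u)) (sym (m+[n∸m]≡n i₀≤i))) (reindex s s'' i₀ (sym s≡) (i ∸ i₀))
    inside : Dec (i ∸ i₀ < ℓ) → pt k (toℕ s'' + i) ∈ interval k s ℓ
    inside (yes d<ℓ) = subst (_∈ interval k s ℓ) (sym atI) (∈interval s ℓ (i ∸ i₀) d<ℓ)
    inside (no d≮ℓ) =
      ⊥-elim (after (subst (_∈ P) (reindex s s'' i₀ (sym s≡) ℓ) (J⊆P (∈interval s'' ℓ'' (i₀ + ℓ) i₀+ℓ<ℓ''))))
      where
      i₀+ℓ<ℓ'' : i₀ + ℓ < ℓ''
      i₀+ℓ<ℓ'' = ≤-<-trans (subst (i₀ + ℓ ≤_) (m+[n∸m]≡n i₀≤i) (+-monoʳ-≤ i₀ (≮⇒≥ d≮ℓ))) i<ℓ''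
  ...   | no i₀≰i =
    ⊥-elim (before (subst (_∈ P) prev≡ (J⊆P (∈interval s'' ℓ'' (i₀ ∸ 1) (≤-<-trans (m∸n≤m i₀ 1) i₀<ℓ'')))))
    where
    prev≡ : pt k (toℕ s'' + (i₀ ∸ 1)) ≡ pt k (toℕ s + (n ∸ 1))
    prev≡ = begin
      pt k (toℕ s'' + (i₀ ∸ 1))                ≡⟨ pt-+n (toℕ s'' + (i₀ ∸ 1)) ⟨
      pt k (toℕ s'' + (i₀ ∸ 1) + n)            ≡⟨ cong (pt k) (+-assoc (toℕ s'') (i₀ ∸ 1) n) ⟩
      pt k (toℕ s'' + ((i₀ ∸ 1) + suc (n ∸ 1))) ≡⟨ cong (λ u → pt k (toℕ s'' + u)) (+-suc (i₀ ∸ 1) (n ∸ 1)) ⟩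
      pt k (toℕ s'' + (suc (i₀ ∸ 1) + (n ∸ 1))) ≡⟨ cong (λ u → pt k (toℕ s'' + (u + (n ∸ 1))))
                                                      (m+[n∸m]≡n {1} (≤-trans (s≤s z≤n) (≰⇒> i₀≰i))) ⟩
      pt k (toℕ s'' + (i₀ + (n ∸ 1)))          ≡⟨ reindex s s'' i₀ (sym s≡) (n ∸ 1) ⟩
      pt k (toℕ s + (n ∸ 1)) ∎
      where open ≡-Reasoning

module Search (Q : ℕ → Set) (Q? : ∀ i → Dec (Q i)) where

  lastBefore : Q 0 → ∀ d → Σ ℕ λ a → (a ≤ d) × Q a × (∀ i → a < i → i ≤ d → ¬ Q i)
  lastBefore q0 zero = 0 , z≤n , q0 , λ i a<i i≤0 _ → <-irrefl refl (<-≤-trans a<i i≤0)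
  lastBefore q0 (suc d) with Q? (suc d)
  ... | yes q = suc d , ≤-refl , q , λ i a<i i≤ _ → <-irrefl refl (<-≤-trans a<i i≤)
  ... | no nq with lastBefore q0 d
  ...   | a , a≤d , qa , none = a , ≤-trans a≤d (n≤1+n d) , qa , none'
    where
    none' : ∀ i → a < i → i ≤ suc d → ¬ Q i
    none' i a<i i≤ with m≤n⇒m<n∨m≡n i≤
    ... | inj₁ i<sd = none i a<i (≤-pred i<sd)
    ... | inj₂ refl = nq

  firstAfter : ∀ d g → Q (d + suc g) → Σ ℕ λ c → (d < c) × (c ≤ d + suc g) × Q c × (∀ i → d < i → i < c → ¬ Q i)
  firstAfter d zero q = suc d , ≤-refl , ≤-reflexive (sym (+-comm d 1)) , subst Q (+-comm d 1) q ,
    λ i d<i i<c _ → <-irrefl refl (<-≤-trans d<i (≤-pred i<c))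
  firstAfter d (suc g) q with Q? (suc d)
  ... | yes q1 = suc d , ≤-refl , subst (suc d ≤_) (sym (+-suc d (suc g))) (s≤s (m≤m+n d (suc g))) , q1 ,
                 λ i d<i i<c _ → <-irrefl refl (<-≤-trans d<i (≤-pred i<c))
  ... | no nq1 with firstAfter (suc d) g (subst Q (+-suc d (suc g)) q)
  ...   | c , sd<c , c≤ , qc , none = c , <-trans (n<1+n d) sd<c , subst (c ≤_) (sym (+-suc d (suc g))) c≤ , qc , none'
    where
    none' : ∀ i → d < i → i < c → ¬ Q i
    none' i d<i i<c with m≤n⇒m<n∨m≡n d<i
    ... | inj₁ sd<i = none i sd<i i<c
    ... | inj₂ refl = nq1

module Bases (k : ℕ) where

  open import Defs using (N; pt; interval; _⊆_; IsBase)
  import Data.Fin.Properties as FinP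
  open import Data.List.Membership.DecPropositional (FinP._≟_ {N k}) using (_∈?_)
  open import Relation.Nullary.Decidable using (decidable-stable)
  open Circle k

  module _ (P : List (Fin n)) where

    BaseThrough : Fin n → Set
    BaseThrough x = Σ (Fin n) λ s → Σ ℕ λ ℓ → IsBase k P s ℓ × (x ∈ interval k s ℓ)

    baseThroughAll : ∀ x → (∀ z → z ∈ P) → BaseThrough x
    baseThroughAll x allP = x , n , ((z<s , ≤-refl) , (λ {y} _ → allP y) , (λ _ _ _ _ _ {y} _ → everything y)) , everything x
      where
      everything : ∀ y → y ∈ interval k x n
      everything y = offset<⇒∈interval x n y (offset<n x y)

    module Walk (z₀ : Fin n) where

      w : ℕ → Fin n
      w d = pt k (toℕ z₀ + d)

      w+n : ∀ d → w (d + n) ≡ w d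
      w+n d = trans (cong (pt k) (sym (+-assoc (toℕ z₀) d n))) (pt-+n (toℕ z₀ + d))

      w-from : ∀ a j → pt k (toℕ (w a) + j) ≡ w (a + j)
      w-from a j = trans (pt-pt (toℕ z₀ + a) j) (cong (pt k) (+-assoc (toℕ z₀) a j))

      gapBase : ∀ a c → suc a < c → c ≤ n → ¬ (w a ∈ P) → ¬ (w c ∈ P) →
        (∀ i → a < i → i < c → w i ∈ P) → IsBase k P (w (suc a)) (c ∸ suc a)
      gapBase a c a+1<c c≤n wa∉P wc∉P present =
        (1≤ℓ , <⇒≤ ℓ<n) , interval⊆P ,
        (λ s'' ℓ'' _ → neighboursOutside⇒maximal P (w (suc a)) (c ∸ suc a) 1≤ℓ ℓ<n before after s'' ℓ'')
        where
        1≤ℓ : 1 ≤ c ∸ suc a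
        1≤ℓ = m<n⇒0<n∸m a+1<c
        ℓ<n : c ∸ suc a < n
        ℓ<n = <-≤-trans (∸-monoʳ-< {c} {suc a} {0} z<s (<⇒≤ a+1<c)) c≤n
        a+1+ℓ≡c : suc a + (c ∸ suc a) ≡ c
        a+1+ℓ≡c = m+[n∸m]≡n (<⇒≤ a+1<c)
        interval⊆P : _⊆_ k (interval k (w (suc a)) (c ∸ suc a)) P
        interval⊆P {y} y∈ with ∈interval⁻ (w (suc a)) (c ∸ suc a) y y∈
        ... | j , j<ℓ , y≡ = subst (_∈ P) (sym (trans y≡ (w-from (suc a) j)))
                               (present (suc a + j) (s≤s (m≤m+n a j)) (subst (suc a + j <_) a+1+ℓ≡c (+-monoʳ-< (suc a) j<ℓ)))
        before : ¬ (pt k (toℕ (w (suc a)) + (n ∸ 1)) ∈ P)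
        before m = wa∉P (subst (_∈ P) (trans (w-from (suc a) (n ∸ 1)) (trans (cong w (sym (+-suc a (n ∸ 1)))) (w+n a))) m)
        after : ¬ (pt k (toℕ (w (suc a)) + (c ∸ suc a)) ∈ P)
        after m = wc∉P (subst (_∈ P) (trans (w-from (suc a) (c ∸ suc a)) (cong w a+1+ℓ≡c)) m)

    -- otherwise walk around the circle from a point z₀ ∉ P: the points
    -- of P around x are bounded by points outside P on both sides
    baseThroughMissing : ∀ x → x ∈ P → ∀ z₀ → ¬ (z₀ ∈ P) → BaseThrough x
    baseThroughMissing x x∈P z₀ z₀∉P
      with lastBefore missing0 dx | firstAfter dx (proj₁ gap) missingN
      where
      open Walk z₀
      Missing : ℕ → Set
      Missing d = ¬ (w d ∈ P)
      Missing? : ∀ d → Dec (Missing d)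
      Missing? d with w d ∈? P
      ... | yes p = no (λ q → q p)
      ... | no p = yes p
      open Search Missing Missing?
      dx = offset z₀ x
      missing0 : Missing 0
      missing0 m = z₀∉P (subst (_∈ P) (pt-+0 z₀) m)
      gap : ∃ λ g → suc dx + g ≡ n
      gap = m≤n⇒∃[o]m+o≡n (offset<n z₀ x)
      missingN : Missing (dx + suc (proj₁ gap))
      missingN = subst Missing (sym (trans (+-suc dx (proj₁ gap)) (proj₂ gap))) (λ m → missing0 (subst (_∈ P) (w+n 0) m))
    ... | a , a≤dx , missingA , noneBefore | c , dx<c , c≤ , missingC , noneAfter =
      w (suc a) , c ∸ suc a , gapBase a c (≤-<-trans a<dx dx<c) c≤n missingA missingC present , x∈interval
      where
      open Walk z₀
      dx = offset z₀ x
      x-at : w dx ≡ x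
      x-at = pt-offset z₀ x
      a<dx : a < dx
      a<dx = ≤∧≢⇒< a≤dx (λ e → missingA (subst (λ d → w d ∈ P) (sym e) (subst (_∈ P) (sym x-at) x∈P)))
      c≤n : c ≤ n
      c≤n = subst (c ≤_) (trans (+-suc dx _) (proj₂ (m≤n⇒∃[o]m+o≡n (offset<n z₀ x)))) c≤
      present : ∀ i → a < i → i < c → w i ∈ P
      present i a<i i<c = decidable-stable (w i ∈? P) notMissing
        where
        notMissing : ¬ ¬ (w i ∈ P)
        notMissing with i ≤? dx
        ... | yes i≤dx = noneBefore i a<i i≤dx
        ... | no i≰dx = noneAfter i (≰⇒> i≰dx) i<c
      x∈interval : x ∈ interval k (w (suc a)) (c ∸ suc a)
      x∈interval = subst (_∈ interval k (w (suc a)) (c ∸ suc a))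
                     (trans (w-from (suc a) (dx ∸ suc a)) (trans (cong w (m+[n∸m]≡n a<dx)) x-at))
                     (∈interval (w (suc a)) (c ∸ suc a) (dx ∸ suc a) (∸-monoˡ-< dx<c a<dx))

    baseThrough : ∀ x → x ∈ P → BaseThrough x
    baseThrough x x∈P with FinP.all? (λ z → z ∈? P)
    ... | yes allP = baseThroughAll x allP
    ... | no notAll with FinP.¬∀⟶∃¬ n (λ z → z ∈ P) (λ z → z ∈? P) notAll
    ...   | z₀ , z₀∉P = baseThroughMissing x x∈P z₀ z₀∉P

    leafVertices⊆base : ∀ {b ℓ} → IsBase k P b ℓ →
      (∀ s ℓ' → IsBase k P s ℓ' →
         (_⊆_ k (interval k s ℓ') (interval k b ℓ)) × (_⊆_ k (interval k b ℓ) (interval k s ℓ'))) →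
      ∀ x → x ∈ P → x ∈ interval k b ℓ
    leafVertices⊆base base unique x x∈P with baseThrough x x∈P
    ... | s , ℓ' , isBase , x∈ = proj₁ (unique s ℓ' isBase) x∈

module Charging where

  open ListFacts using (sumBelow)
  open BoolFacts
  open import Data.Nat using (_≡ᵇ_)
  open import Data.Nat.ListAction using (sum)

  without : (ℕ → ℕ) → ℕ → ℕ → ℕ
  without cap j i = if i ≡ᵇ j then 0 else cap i

  sumBelow-ext : ∀ L (f g : ℕ → ℕ) → (∀ i → i < L → f i ≡ g i) → sumBelow L f ≡ sumBelow L g
  sumBelow-ext zero f g _ = refl
  sumBelow-ext (suc L) f g same = cong₂ _+_ (sumBelow-ext L f g (λ i i< → same i (m<n⇒m<1+n i<))) (same L ≤-refl)

  without-same : ∀ cap j → without cap j j ≡ 0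
  without-same cap j rewrite T⇒≡true (≡⇒≡ᵇ j j refl) = refl

  without-other : ∀ cap j i → i ≢ j → without cap j i ≡ cap i
  without-other cap j i i≢j with i ≡ᵇ j in e
  ... | true = ⊥-elim (i≢j (≡ᵇ⇒≡ i j (≡true⇒T e)))
  ... | false = refl

  sumBelow-without : ∀ L cap j → j < L → sumBelow L cap ≡ cap j + sumBelow L (without cap j)
  sumBelow-without (suc L) cap j j<L with j ≟ L
  ... | yes refl = begin
    sumBelow L cap + cap L                         ≡⟨ +-comm (sumBelow L cap) (cap L) ⟩
    cap L + sumBelow L cap                         ≡⟨ cong (cap L +_) (sumBelow-ext L cap (without cap L)
                                                        (λ i i<L → sym (without-other cap L i (<⇒≢ i<L)))) ⟩
    cap L + sumBelow L (without cap L)             ≡⟨ cong (cap L +_) (+-identityʳ _) ⟨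
    cap L + (sumBelow L (without cap L) + 0)       ≡⟨ cong (λ z → cap L + (sumBelow L (without cap L) + z)) (without-same cap L) ⟨
    cap L + sumBelow (suc L) (without cap L) ∎
    where open ≡-Reasoning
  ... | no j≢L = begin
    sumBelow L cap + cap L                                 ≡⟨ cong (_+ cap L) (sumBelow-without L cap j (≤∧≢⇒< (≤-pred j<L) j≢L)) ⟩
    cap j + sumBelow L (without cap j) + cap L             ≡⟨ +-assoc (cap j) _ (cap L) ⟩
    cap j + (sumBelow L (without cap j) + cap L)           ≡⟨ cong (λ z → cap j + (sumBelow L (without cap j) + z))
                                                                (without-other cap j L (λ e → j≢L (sym e))) ⟨
    cap j + sumBelow (suc L) (without cap j) ∎
    where open ≡-Reasoning

  module _ {A : Set} (f : A → ℕ) (slot : A → ℕ) (L : ℕ) where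

    chargeSum : ∀ xs (cap : ℕ → ℕ) → Unique xs → (∀ x → x ∈ xs → 0 < f x → slot x < L) →
             (∀ x y → x ∈ xs → y ∈ xs → 0 < f x → 0 < f y → slot x ≡ slot y → x ≡ y) →
             (∀ x → x ∈ xs → f x ≤ cap (slot x)) → sum (map f xs) ≤ sumBelow L cap
    chargeSum [] _ _ _ _ _ = z≤n
    chargeSum (x ∷ xs) cap (x∉ ∷ u) inRange distinct bounded with f x in fx
    ... | zero = chargeSum xs cap u (λ y m → inRange y (there m)) (λ y z my mz → distinct y z (there my) (there mz))
                   (λ y m → bounded y (there m))
    ... | suc v = subst (suc v + sum (map f xs) ≤_) (sym (sumBelow-without L cap (slot x) (inRange x (here refl) fx>0)))
                    (+-mono-≤ (subst (_≤ cap (slot x)) fx (bounded x (here refl)))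
                      (chargeSum xs (without cap (slot x)) u (λ y m → inRange y (there m))
                         (λ y z my mz → distinct y z (there my) (there mz)) boundedRest))
      where
      fx>0 : 0 < f x
      fx>0 = subst (0 <_) (sym fx) z<s
      boundedRest : ∀ y → y ∈ xs → f y ≤ without cap (slot x) (slot y)
      boundedRest y y∈ with slot y ≟ slot x
      ... | no ne = subst (f y ≤_) (sym (without-other cap (slot x) (slot y) ne)) (bounded y (there y∈))
      ... | yes e with f y in fy
      ...   | zero = z≤n
      ...   | suc _ = ⊥-elim (lookup x∉ y∈ (distinct x y (here refl) (there y∈) fx>0 (subst (0 <_) (sym fy) z<s) (sym e)))

  sum-positive : ∀ {A : Set} (f : A → ℕ) xs → 0 < sum (map f xs) → ∃ λ x → (x ∈ xs) × (0 < f x)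
  sum-positive f (y ∷ ys) pos with f y in fy
  ... | suc _ = y , here refl , subst (0 <_) (sym fy) z<s
  ... | zero with sum-positive f ys pos
  ...   | x , x∈ , fx>0 = x , there x∈ , fx>0

module Runs (k : ℕ) (col : Fin (Defs.N k) → Bool) where

  open import Defs using (pt; interval; isRun; _==_)
  open Circle k
  open BoolFacts
  open ListFacts using (all-sound)
  open import Relation.Binary.Definitions using (tri<; tri≈; tri>)
  open import Data.Nat.Tactic.RingSolver using (solve-∀)

  ==-sound : ∀ {a c} → _==_ k a c ≡ true → a ≡ c
  ==-sound {true} {true} _ = refl
  ==-sound {false} {false} _ = refl

  not==-sound : ∀ {a c} → not (_==_ k a c) ≡ true → a ≢ c
  not==-sound {true} {true} ()
  not==-sound {false} {false} ()

  record Run (s : Fin n) (ℓ : ℕ) : Set where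
    field
      nonempty : 1 ≤ ℓ
      same : ∀ i → i < ℓ → col (pt k (toℕ s + i)) ≡ col s
      after : col (pt k (toℕ s + ℓ)) ≢ col s
      before : col (pt k (toℕ s + (n ∸ 1))) ≢ col s

  and5 : ∀ a b c d e → (a ∧ b ∧ c ∧ d ∧ e) ≡ true → (a ≡ true) × (b ≡ true) × (c ≡ true) × (d ≡ true) × (e ≡ true)
  and5 true true true true true _ = refl , refl , refl , refl , refl

  isRun-sound : ∀ s ℓ → isRun k col s ℓ ≡ true → Run s ℓ
  isRun-sound s ℓ e = let (long , _ , mono , aft , bef) = and5 _ (ℓ <ᵇ n) _ _ _ e in record
    { nonempty = ≤ᵇ⇒≤ 1 ℓ (≡true⇒T long)
    ; same = λ i i<ℓ → ==-sound (all-sound (λ x → _==_ k (col x) (col s)) (interval k s ℓ) mono (∈interval s ℓ i i<ℓ))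
    ; after = not==-sound aft
    ; before = not==-sound bef
    }

  run-length-unique : ∀ s ℓ₁ ℓ₂ → Run s ℓ₁ → Run s ℓ₂ → ℓ₁ ≡ ℓ₂
  run-length-unique s ℓ₁ ℓ₂ r₁ r₂ with <-cmp ℓ₁ ℓ₂
  ... | tri≈ _ e _ = e
  ... | tri< lt _ _ = ⊥-elim (Run.after r₁ (Run.same r₂ ℓ₁ lt))
  ... | tri> _ _ gt = ⊥-elim (Run.after r₂ (Run.same r₁ ℓ₂ gt))

  runs-disjoint : ∀ s₁ s₂ ℓ₁ ℓ₂ i₁ i₂ → Run s₁ ℓ₁ → Run s₂ ℓ₂ → i₁ < ℓ₁ → i₂ < ℓ₂ → i₁ ≤ i₂ →
    pt k (toℕ s₁ + i₁) ≡ pt k (toℕ s₂ + i₂) → s₁ ≡ s₂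
  runs-disjoint s₁ s₂ ℓ₁ ℓ₂ i₁ i₂ r₁ r₂ i₁< i₂< i₁≤i₂ meet with i₂ ∸ i₁ in d≡
  ... | zero = trans s₁-at (pt-+0 s₂)
    where
    s₁-at : s₁ ≡ pt k (toℕ s₂ + 0)
    s₁-at = subst (λ d → s₁ ≡ pt k (toℕ s₂ + d)) d≡ (startInside s₁ s₂ i₁ i₂ i₁≤i₂ meet)
  ... | suc d₁ = ⊥-elim (Run.before r₁ (trans (cong col prev≡) (trans (Run.same r₂ d₁ d₁<ℓ₂) (sym colour-s₁))))
    where
    s₁-at : s₁ ≡ pt k (toℕ s₂ + suc d₁)
    s₁-at = subst (λ d → s₁ ≡ pt k (toℕ s₂ + d)) d≡ (startInside s₁ s₂ i₁ i₂ i₁≤i₂ meet)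
    d<ℓ₂ : suc d₁ < ℓ₂
    d<ℓ₂ = ≤-<-trans (subst (_≤ i₂) d≡ (m∸n≤m i₂ i₁)) i₂<
    d₁<ℓ₂ : d₁ < ℓ₂
    d₁<ℓ₂ = <-trans (n<1+n d₁) d<ℓ₂
    colour-s₁ : col s₁ ≡ col s₂
    colour-s₁ = trans (cong col s₁-at) (Run.same r₂ (suc d₁) d<ℓ₂)
    prev≡ : pt k (toℕ s₁ + (n ∸ 1)) ≡ pt k (toℕ s₂ + d₁)
    prev≡ = begin
      pt k (toℕ s₁ + (n ∸ 1))                       ≡⟨ cong (λ z → pt k (toℕ z + (n ∸ 1))) s₁-at ⟩
      pt k (toℕ (pt k (toℕ s₂ + suc d₁)) + (n ∸ 1)) ≡⟨ pt-pt (toℕ s₂ + suc d₁) (n ∸ 1) ⟩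
      pt k (toℕ s₂ + suc d₁ + (n ∸ 1))              ≡⟨ cong (pt k) (shift (toℕ s₂) d₁ (n ∸ 1)) ⟩
      pt k (toℕ s₂ + d₁ + n)                        ≡⟨ pt-+n (toℕ s₂ + d₁) ⟩
      pt k (toℕ s₂ + d₁) ∎
      where
      open ≡-Reasoning
      shift : ∀ a d m → a + suc d + m ≡ a + d + suc m
      shift = solve-∀

-- If the colouring seen from b is the pattern at phase t and all vertices of
-- P lie in the window of L ≤ 15 points starting at b, then twice the weight
-- of P is at most windowWeight t L: every run with nonzero score is charged
-- to a distinct window position (its start, or 0), and its score is at most
-- the positionWeight there.
module WeightBound (k : ℕ) (col : Fin (Defs.N k) → Bool) (P : List (Fin (Defs.N k))) (b : Fin (Defs.N k)) (L t : ℕ)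
  (colour : ∀ x → col x ≡ Pattern.pat t (Circle.offset k b x))
  (inWindow : ∀ x → x ∈ P → Circle.offset k b x < L)
  (1≤L : 1 ≤ L) (L≤15 : L ≤ 15) where

  open import Defs using (N; pt; interval; isRun; _∈ᵇ_; runScore2; weight2)
  open Circle k
  open Runs k col
  open Pattern
  open WindowWeight
  open Charging
  open BoolFacts
  open ListFacts
  import Data.Fin as Fin
  open import Data.Nat.DivMod
  open import Data.Nat.ListAction using (sum)
  open import Data.Bool.ListAction using (all; any)
  open import Data.List using (upTo; allFin)
  open import Data.List.Relation.Unary.Unique.Propositional.Properties using (upTo⁺; allFin⁺)

  L<n : L < n
  L<n = ≤-<-trans L≤15 (subst (15 <_) (sym n≡16+k*16) (s≤s (m≤m+n 15 (k * 16))))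

  colour-at : ∀ s i → col (pt k (toℕ s + i)) ≡ pat t (offset b s + i)
  colour-at s i = trans (colour _) (trans (cong (pat t) (offset-shift b s i))
                    (pat-mod t n 16∣n (offset b s + i)))

  pat-back : ∀ u → pat t (u + (n ∸ 1)) ≡ pat t (u + 15)
  pat-back u = cong Defs.pattern16 (begin
    (t + (u + (n ∸ 1))) % 16       ≡⟨ cong (λ m → (t + (u + (m ∸ 1))) % 16) n≡16+k*16 ⟩
    (t + (u + (15 + k * 16))) % 16 ≡⟨ cong (_% 16) (reassoc t u (k * 16)) ⟩
    (t + (u + 15) + k * 16) % 16   ≡⟨ [m+kn]%n≡m%n (t + (u + 15)) k 16 ⟩
    (t + (u + 15)) % 16 ∎)
    where
    open ≡-Reasoning
    reassoc : ∀ t u m → t + (u + (15 + m)) ≡ t + (u + 15) + m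
    reassoc t u m = trans (cong (t +_) (sym (+-assoc u 15 m))) (sym (+-assoc t (u + 15) m))

  ∈ᵇ-sound : ∀ x → _∈ᵇ_ k x P ≡ true → x ∈ P
  ∈ᵇ-sound x e with any-sound (λ y → does (x Fin.≟ y)) P e
  ... | y , y∈ , same with x Fin.≟ y
  ...   | yes refl = y∈
  ...   | no _ with same
  ...     | ()

  runTerm : Fin n → ℕ → ℕ
  runTerm s ℓ = if isRun k col s ℓ then runScore2 k P (interval k s ℓ) else 0

  runsAt : Fin n → ℕ
  runsAt s = sum (map (runTerm s) (upTo n))

  runTerm-positive : ∀ s ℓ → 0 < runTerm s ℓ → Run s ℓ
  runTerm-positive s ℓ pos with isRun k col s ℓ in r
  ... | true = isRun-sound s ℓ r

  slot : Fin n → ℕ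
  slot s = if offset b s <ᵇ L then offset b s else 0

  slot-inside : ∀ s → offset b s < L → slot s ≡ offset b s
  slot-inside s j<L rewrite <ᵇ-true j<L = refl

  slot-outside : ∀ s → ¬ (offset b s < L) → slot s ≡ 0
  slot-outside s j≮L rewrite <ᵇ-false j≮L = refl

  slot<L : ∀ s → slot s < L
  slot<L s with offset b s <? L
  ... | yes j<L = subst (_< L) (sym (slot-inside s j<L)) j<L
  ... | no j≮L = subst (_< L) (sym (slot-outside s j≮L)) 1≤L

  allIn : List (Fin n) → Bool
  allIn R = all (λ x → _∈ᵇ_ k x P) R

  someIn : List (Fin n) → Bool
  someIn R = any (λ x → _∈ᵇ_ k x P) R

  score-notAll : ∀ R → allIn R ≡ false → runScore2 k P R ≤ 1
  score-notAll R e rewrite e with someIn R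
  ... | true = ≤-refl
  ... | false = z≤n

  score-all : ∀ R → allIn R ≡ true → runScore2 k P R ≡ 2
  score-all R e rewrite e = refl

  score-positive : ∀ R → 0 < runScore2 k P R → (allIn R ≡ true) ⊎ (someIn R ≡ true)
  score-positive R pos with allIn R | someIn R
  ... | true | _ = inj₁ refl
  ... | false | true = inj₂ refl

  inWindow-at : ∀ s i → _∈ᵇ_ k (pt k (toℕ s + i)) P ≡ true → (offset b s + i) % n < L
  inWindow-at s i e = subst (_< L) (offset-shift b s i) (inWindow (pt k (toℕ s + i)) (∈ᵇ-sound (pt k (toℕ s + i)) e))

  allIn-run : ∀ s ℓ → allIn (interval k s ℓ) ≡ true → ∀ i → i < ℓ → (offset b s + i) % n < L
  allIn-run s ℓ e i i<ℓ = inWindow-at s i (all-sound _ (interval k s ℓ) e (∈interval s ℓ i i<ℓ))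

  run-starts : ∀ s ℓ → Run s ℓ → runStart t (offset b s) ≡ true
  run-starts s ℓ r = xor-≢ (λ e → Run.before r (trans (colour-at s (n ∸ 1)) (trans (pat-back (offset b s))
                       (trans e (sym (trans (colour s) refl))))))

  run-fits : ∀ s ℓ → Run s ℓ → offset b s < L → allIn (interval k s ℓ) ≡ true →
    offset b s + runLength t (offset b s) ≤ L
  run-fits s ℓ r j<L e = ≤-trans (+-monoʳ-≤ (offset b s) runLength≤ℓ) j+ℓ≤L
    where
    j = offset b s
    j+ℓ≤L : j + ℓ ≤ L
    j+ℓ≤L with j + ℓ ≤? L
    ... | yes q = q
    ... | no q = ⊥-elim (<-irrefl refl (subst (_< L) (trans (cong (_% n) (m+[n∸m]≡n (<⇒≤ j<L))) (m<n⇒m%n≡m L<n))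
                   (allIn-run s ℓ e (L ∸ j) (+-cancelˡ-< j _ _ (subst (_< j + ℓ) (sym (m+[n∸m]≡n (<⇒≤ j<L))) (≰⇒> q))))))
    ℓ≤L : ℓ ≤ L
    ℓ≤L = ≤-trans (m≤n+m ℓ j) j+ℓ≤L
    runLength≤ℓ : runLength t j ≤ ℓ
    runLength≤ℓ = runEnd-≤ 16 t j 1 ℓ (Run.nonempty r) (≤-trans ℓ≤L (≤-trans L≤15 (m≤n+m 15 2)))
                    (λ e → Run.after r (trans (colour-at s ℓ) (trans e (sym (colour s)))))

  runScore≤ : ∀ s ℓ → Run s ℓ → runScore2 k P (interval k s ℓ) ≤ positionWeight t L (slot s)
  runScore≤ s ℓ r = bound (offset b s <? L) (allIn (interval k s ℓ)) refl
    where
    R = interval k s ℓ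
    bound : Dec (offset b s < L) → ∀ a → allIn R ≡ a → runScore2 k P R ≤ positionWeight t L (slot s)
    bound (yes j<L) true all? =
      ≤-reflexive (trans (score-all R all?) (sym (trans (cong (positionWeight t L) (slot-inside s j<L))
        (positionWeight-inside t L (offset b s) (run-starts s ℓ r) (run-fits s ℓ r j<L all?)))))
    bound (yes j<L) false notAll =
      subst (λ j → runScore2 k P R ≤ positionWeight t L j) (sym (slot-inside s j<L))
        (≤-trans (score-notAll R notAll) (positionWeight-start t L (offset b s) (run-starts s ℓ r)))
    bound (no j≮L) true all? =
      ⊥-elim (j≮L (subst (_< L) (trans (cong (_% n) (+-identityʳ (offset b s))) (m<n⇒m%n≡m (offset<n b s)))
                    (allIn-run s ℓ all? 0 (Run.nonempty r))))
    bound (no j≮L) false notAll =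
      subst (λ j → runScore2 k P R ≤ positionWeight t L j) (sym (slot-outside s j≮L))
        (≤-trans (score-notAll R notAll) (positionWeight-0 t L))

  runTerm≤ : ∀ s ℓ → runTerm s ℓ ≤ positionWeight t L (slot s)
  runTerm≤ s ℓ with isRun k col s ℓ in isr
  ... | false = z≤n
  ... | true = runScore≤ s ℓ (isRun-sound s ℓ isr)

  -- at most one run starts at s
  runsAt≤ : ∀ s → runsAt s ≤ positionWeight t L (slot s)
  runsAt≤ s = chargeSum (runTerm s) (λ _ → 0) 1 (upTo n) (λ _ → positionWeight t L (slot s)) (upTo⁺ n)
                (λ _ _ _ → z<s)
                (λ ℓ₁ ℓ₂ _ _ p₁ p₂ _ → run-length-unique s ℓ₁ ℓ₂ (runTerm-positive s ℓ₁ p₁) (runTerm-positive s ℓ₂ p₂))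
                (λ ℓ _ → runTerm≤ s ℓ)

  -- a run with nonzero score has a point in P, hence in the window
  scoringRun : ∀ s → 0 < runsAt s → Σ ℕ λ ℓ → Run s ℓ × (Σ ℕ λ i → (i < ℓ) × ((offset b s + i) % n < L))
  scoringRun s pos with sum-positive (runTerm s) (upTo n) pos
  ... | ℓ , _ , termPos with isRun k col s ℓ in isr
  ...   | true = ℓ , r , meets (score-positive (interval k s ℓ) termPos)
    where
    r : Run s ℓ
    r = isRun-sound s ℓ isr
    meets : (allIn (interval k s ℓ) ≡ true) ⊎ (someIn (interval k s ℓ) ≡ true) →
            Σ ℕ λ i → (i < ℓ) × ((offset b s + i) % n < L)
    meets (inj₁ all?) = 0 , Run.nonempty r , allIn-run s ℓ all? 0 (Run.nonempty r)
    meets (inj₂ some?) with any-sound (λ x → _∈ᵇ_ k x P) (interval k s ℓ) some?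
    ... | x , x∈ , x∈P with ∈interval⁻ s ℓ x x∈
    ...   | i , i<ℓ , refl = i , i<ℓ , inWindow-at s i x∈P

  slotInRun : ∀ s → 0 < runsAt s → Σ ℕ λ ℓ → Run s ℓ × (Σ ℕ λ i → (i < ℓ) × (pt k (toℕ s + i) ≡ pt k (toℕ b + slot s)))
  slotInRun s pos with scoringRun s pos
  ... | ℓ , r , i₀ , i₀<ℓ , i₀-inside with offset b s <? L
  ...   | yes j<L = ℓ , r , 0 , Run.nonempty r ,
                    trans (pt-+0 s) (trans (sym (pt-offset b s)) (cong (λ z → pt k (toℕ b + z)) (sym (slot-inside s j<L))))
  ...   | no j≮L = ℓ , r , n ∸ j , n∸j<ℓ ,
                   trans (offset-inj b atWindowStart) (cong (λ z → pt k (toℕ b + z)) (sym (slot-outside s j≮L)))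
    where
    j = offset b s
    -- the run passes position 0 of the window, n - j steps after its start
    n≤j+i₀ : n ≤ j + i₀
    n≤j+i₀ with j + i₀ <? n
    ... | no q = ≮⇒≥ q
    ... | yes q = ⊥-elim (j≮L (≤-<-trans (m≤m+n j i₀) (subst (_< L) (m<n⇒m%n≡m q) i₀-inside)))
    n∸j<ℓ : n ∸ j < ℓ
    n∸j<ℓ = ≤-<-trans (subst (n ∸ j ≤_) (m+n∸m≡n j i₀) (∸-monoˡ-≤ j n≤j+i₀)) i₀<ℓ
    atWindowStart : offset b (pt k (toℕ s + (n ∸ j))) ≡ offset b (pt k (toℕ b + 0))
    atWindowStart = begin
      offset b (pt k (toℕ s + (n ∸ j))) ≡⟨ offset-shift b s (n ∸ j) ⟩
      (j + (n ∸ j)) % n                ≡⟨ cong (_% n) (m+[n∸m]≡n (<⇒≤ (offset<n b s))) ⟩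
      n % n                            ≡⟨ n%n≡0 n ⟩
      0                                ≡⟨ trans (cong (offset b) (pt-+0 b)) (offset-self b) ⟨
      offset b (pt k (toℕ b + 0))      ∎
      where open ≡-Reasoning

  slot-injective : ∀ s₁ s₂ → 0 < runsAt s₁ → 0 < runsAt s₂ → slot s₁ ≡ slot s₂ → s₁ ≡ s₂
  slot-injective s₁ s₂ p₁ p₂ same with slotInRun s₁ p₁ | slotInRun s₂ p₂
  ... | ℓ₁ , r₁ , i₁ , i₁< , at₁ | ℓ₂ , r₂ , i₂ , i₂< , at₂ with i₁ ≤? i₂
  ...   | yes i₁≤i₂ = runs-disjoint s₁ s₂ ℓ₁ ℓ₂ i₁ i₂ r₁ r₂ i₁< i₂< i₁≤i₂
                        (trans at₁ (trans (cong (λ z → pt k (toℕ b + z)) same) (sym at₂)))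
  ...   | no i₁≰i₂ = sym (runs-disjoint s₂ s₁ ℓ₂ ℓ₁ i₂ i₁ r₂ r₁ i₂< i₁< (<⇒≤ (≰⇒> i₁≰i₂))
                         (trans at₂ (trans (cong (λ z → pt k (toℕ b + z)) (sym same)) (sym at₁))))

  weightBound : weight2 k col P ≤ windowWeight t L
  weightBound = chargeSum runsAt slot L (allFin n) (positionWeight t L) (allFin⁺ n) (λ s _ _ → slot<L s)
                  (λ s₁ s₂ _ _ → slot-injective s₁ s₂) (λ s _ → runsAt≤ s)

module Relabel (k : ℕ) where

  open import Defs using (edges)
  open Chords using (edgesN)
  import Data.List.Relation.Unary.All.Properties as AllP

  edgesN-map : ∀ (f : Fin (Defs.N k) → ℕ) xs → edgesN (map f xs) ≡ map (λ e → (f (proj₁ e) , f (proj₂ e))) (edges k xs)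
  edgesN-map f [] = refl
  edgesN-map f (a ∷ []) = refl
  edgesN-map f (a ∷ b ∷ xs) = cong ((f a , f b) ∷_) (edgesN-map f (b ∷ xs))

  edge-endpoints : ∀ {a b} xs → (a , b) ∈ edges k xs → (a ∈ xs) × (b ∈ xs)
  edge-endpoints (x ∷ y ∷ xs) (here refl) = here refl , there (here refl)
  edge-endpoints (x ∷ y ∷ xs) (there e∈) = let (a∈ , b∈) = edge-endpoints (y ∷ xs) e∈ in there a∈ , there b∈

  map-unique : ∀ {A B : Set} (f : A → B) xs → Unique xs → (∀ x y → x ∈ xs → y ∈ xs → f x ≡ f y → x ≡ y) →
    Unique (map f xs)
  map-unique f [] u inj = []
  map-unique f (x ∷ xs) (x∉ ∷ u) inj =
    AllP.map⁺ (Data.List.Relation.Unary.All.tabulate (λ {y} y∈ e → lookup x∉ y∈ (inj x y (here refl) (there y∈) e)))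
    ∷ map-unique f xs u (λ a b a∈ b∈ e → inj a b (there a∈) (there b∈) e)

-- A leaf P = v₁ ∷ rest whose vertices all lie in its base [b, b + ℓ).  Put
-- p = offset of v₁ and ℓ = σ + p + 1.  Relabel each vertex y by the position
-- cut y of its offset after cutting the base just after v₁ (so v₁ becomes
-- σ + p, the last position).  The colours become rotColour, crossings are
-- preserved, and the rest of the path fills positions 0 … σ + p - 1; hence,
-- by the peeling lemma, it peels them.
module LeafPeeling (k : ℕ) (col : Fin (Defs.N k) → Bool) (t : ℕ) (b : Fin (Defs.N k)) (ℓ : ℕ)
  (colour : ∀ x → col x ≡ Pattern.pat t (Circle.offset k b x))
  (v₁ : Fin (Defs.N k)) (rest : List (Fin (Defs.N k)))
  (distinct : Unique (v₁ ∷ rest))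
  (alternating : All (λ e → col (proj₁ e) ≢ col (proj₂ e)) (Defs.edges k (v₁ ∷ rest)))
  (nonCrossing : ∀ e f → e ∈ Defs.edges k (v₁ ∷ rest) → f ∈ Defs.edges k (v₁ ∷ rest) → ¬ Defs.Crosses k e f)
  (ℓ≤n : ℓ ≤ Defs.N k)
  (base⊆P : Defs._⊆_ k (Defs.interval k b ℓ) (v₁ ∷ rest))
  (inBase : ∀ x → x ∈ v₁ ∷ rest → Circle.offset k b x < ℓ) where

  open import Defs using (pt; edges)
  open Circle k
  open Chords
  open Relabel k
  open BoolFacts
  open MinMaxCrossing using (Xc⇒CrossesN)
  open import Data.Nat.DivMod
  open import Data.List.Membership.Propositional.Properties using (∈-map⁺; ∈-map⁻)
  import Data.Fin.Properties as FinP
  import Data.List.Relation.Unary.All.Properties as AllP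

  P : List (Fin n)
  P = v₁ ∷ rest

  p : ℕ
  p = offset b v₁

  σ : ℕ
  σ = proj₁ (m≤n⇒∃[o]m+o≡n (inBase v₁ (here refl)))

  ℓ≡ : ℓ ≡ suc (σ + p)
  ℓ≡ = trans (sym (proj₂ (m≤n⇒∃[o]m+o≡n (inBase v₁ (here refl))))) (cong suc (+-comm p σ))

  open SplitWindow t σ p using (L; rotColour)
  module Cut = Rotation.Rotate (suc p) σ

  suc-p+σ≡L : suc p + σ ≡ L
  suc-p+σ≡L = cong suc (+-comm p σ)

  inL : ∀ x → x ∈ P → offset b x < L
  inL x x∈ = subst (offset b x <_) ℓ≡ (inBase x x∈)

  cut : Fin n → ℕ
  cut y = Cut.rot (offset b y)

  cut-v₁ : cut v₁ ≡ σ + p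
  cut-v₁ = trans (Cut.rot-low (n<1+n p)) (+-comm p σ)

  uncut : ∀ r → r < L → (Cut.rot r + suc p) % L ≡ r
  uncut = Cut.unrot-rot L suc-p+σ≡L

  cut<L : ∀ r → r < L → Cut.rot r < L
  cut<L r r<L = subst (_< L) (Cut.rot-mod L suc-p+σ≡L r r<L) (m%n<n (r + σ) L)

  cut-injective : ∀ x y → x ∈ P → y ∈ P → cut x ≡ cut y → x ≡ y
  cut-injective x y x∈ y∈ e = offset-inj b (trans (sym (uncut (offset b x) (inL x x∈)))
                                (trans (cong (λ z → (z + suc p) % L) e) (uncut (offset b y) (inL y y∈))))

  cut-colour : ∀ y → y ∈ P → col y ≡ rotColour (cut y)
  cut-colour y y∈ = trans (colour y) (cong (Pattern.pat t) (sym (uncut (offset b y) (inL y y∈))))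

  -- crossing of the relabelled chords is crossing on the circle: both the
  -- offsets from b and the cut are rotations
  cut-reflects-crossing : ∀ a a' c d → a ∈ P → a' ∈ P → c ∈ P → d ∈ P →
    Xc (cut a , cut a') (cut c , cut d) → Defs.Crosses k (a , a') (c , d)
  cut-reflects-crossing a a' c d a∈ a'∈ c∈ d∈ x =
    Xc⇒CrossesN (toℕ a) (toℕ a') (toℕ c) (toℕ d)
      (FromB.rot-reflects-crossing (toℕ a) (toℕ a') (toℕ c) (toℕ d) (onCircle a) (onCircle a') (onCircle c) (onCircle d)
        (subst₂ Xc (cong₂ _,_ (offset-rot a) (offset-rot a')) (cong₂ _,_ (offset-rot c) (offset-rot d))
          (Cut.rot-reflects-crossing (offset b a) (offset b a') (offset b c) (offset b d)
             (inCut a a∈) (inCut a' a'∈) (inCut c c∈) (inCut d d∈) x)))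
    where
    module FromB = Rotation.Rotate (toℕ b) (n ∸ toℕ b)
    offset-rot : ∀ x → offset b x ≡ FromB.rot (toℕ x)
    offset-rot x = FromB.rot-mod n (m+[n∸m]≡n (toℕ≤n b)) (toℕ x) (FinP.toℕ<n x)
    onCircle : ∀ x → toℕ x < toℕ b + (n ∸ toℕ b)
    onCircle x = subst (toℕ x <_) (sym (m+[n∸m]≡n (toℕ≤n b))) (FinP.toℕ<n x)
    inCut : ∀ x → x ∈ P → offset b x < suc p + σ
    inCut x x∈ = subst (offset b x <_) (sym suc-p+σ≡L) (inL x x∈)

  edge∈ : ∀ {e} → e ∈ edgesN (map cut P) → ∃ λ ((a , a') : Fin n × Fin n) → ((a , a') ∈ edges k P) × (e ≡ (cut a , cut a'))
  edge∈ e∈ = ∈-map⁻ (λ e → (cut (proj₁ e) , cut (proj₂ e))) (subst (_ ∈_) (edgesN-map cut P) e∈)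

  cut-nonCrossing : NonCrossingN (map cut P)
  cut-nonCrossing e f e∈ f∈ crossing with edge∈ e∈ | edge∈ f∈
  ... | (a , a') , aa'∈ , e≡ | (c , d) , cd∈ , f≡ =
    let (a∈ , a'∈) = edge-endpoints P aa'∈
        (c∈ , d∈) = edge-endpoints P cd∈
    in nonCrossing (a , a') (c , d) aa'∈ cd∈ (cut-reflects-crossing a a' c d a∈ a'∈ c∈ d∈ (subst₂ Xc e≡ f≡ crossing))

  cut-alternating : AlternatingN rotColour (map cut P)
  cut-alternating = subst (All (λ e → rotColour (proj₁ e) ≢ rotColour (proj₂ e))) (sym (edgesN-map cut P))
    (AllP.map⁺ (Data.List.Relation.Unary.All.tabulate (λ { {(a , a')} aa'∈ same →
      let (a∈ , a'∈) = edge-endpoints P aa'∈ in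
      lookup alternating aa'∈ (trans (cut-colour a a∈) (trans same (sym (cut-colour a' a'∈)))) })))

  rest-fills : Fills (map cut rest) 0 (σ + p)
  rest-fills = inside , cover
    where
    inside : ∀ z → z ∈ map cut rest → 0 ≤ z × z < 0 + (σ + p)
    inside z z∈ with ∈-map⁻ cut z∈
    ... | y , y∈ , refl = z≤n , ≤∧≢⇒< (≤-pred (cut<L (offset b y) (inL y (there y∈))))
                                      (λ e → lookup (Data.List.Relation.Unary.AllPairs.head distinct) y∈
                                               (sym (cut-injective y v₁ (there y∈) (here refl) (trans e (sym cut-v₁)))))
    cover : ∀ z → 0 ≤ z → z < 0 + (σ + p) → z ∈ map cut rest
    cover z _ z< = subst (_∈ map cut rest) cut-y≡z (∈-map⁺ cut y∈rest)
      where
      r = (z + suc p) % L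
      r<ℓ : r < ℓ
      r<ℓ = subst (r <_) (sym ℓ≡) (m%n<n (z + suc p) L)
      y = pt k (toℕ b + r)
      offset-y : offset b y ≡ r
      offset-y = trans (offset-pt b r) (m<n⇒m%n≡m (<-≤-trans r<ℓ ℓ≤n))
      cut-y≡z : cut y ≡ z
      cut-y≡z = trans (cong Cut.rot offset-y) (Cut.rot-unrot L suc-p+σ≡L z (<-trans z< (n<1+n _)))
      y∈rest : y ∈ rest
      y∈rest with base⊆P (∈interval b ℓ r r<ℓ)
      ... | here y≡v₁ = ⊥-elim (<-irrefl (trans (sym cut-y≡z) (trans (cong cut y≡v₁) cut-v₁)) z<)
      ... | there y∈ = y∈

  peels : Peel rotColour 0 (σ + p) (rotColour (σ + p))
  peels = subst (λ z → Peel rotColour 0 (σ + p) (rotColour z)) cut-v₁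
            (peelPath rotColour (cut v₁) (map cut rest) 0 (σ + p) rest-fills
               (map-unique cut P distinct cut-injective) cut-nonCrossing cut-alternating)

module Phase (k : ℕ) (col : Fin (Defs.N k) → Bool) (o : ℕ)
  (periodic : ∀ x → col x ≡ Defs.pattern16 ((toℕ x + o) % 16)) where

  open Circle k
  open Pattern
  open import Data.Nat.Tactic.RingSolver using (solve-∀)

  phase : Fin n → ℕ
  phase b = (toℕ b + o) % 16

  colour-from : ∀ b x → col x ≡ pat (phase b) (offset b x)
  colour-from b x = begin
    col x                                   ≡⟨ periodic x ⟩
    Defs.pattern16 ((toℕ x + o) % 16)        ≡⟨ cong (λ z → Defs.pattern16 (z % 16)) (+-comm (toℕ x) o) ⟩
    pat o (toℕ x)                            ≡⟨ cong (λ z → pat o (toℕ z)) (pt-offset b x) ⟨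
    pat o (toℕ (Defs.pt k (B + r)))          ≡⟨ cong (pat o) (toℕ-pt (B + r)) ⟩
    pat o ((B + r) % n)                      ≡⟨ pat-mod o n 16∣n (B + r) ⟩
    Defs.pattern16 ((o + (B + r)) % 16)      ≡⟨ cong (λ z → Defs.pattern16 (z % 16)) (regroup o B r) ⟩
    Defs.pattern16 ((B + o + r) % 16)        ≡⟨ cong Defs.pattern16 (%16-absorbˡ (B + o) r) ⟨
    pat (phase b) r ∎
    where
    open ≡-Reasoning
    B = toℕ b
    r = offset b x
    regroup : ∀ o B r → o + (B + r) ≡ B + o + r
    regroup = solve-∀

open import Defs
open import Data.List.Membership.Propositional.Properties using (∈-map⁺; ∈-concat⁺′)
open import Data.Nat.DivMod using (m%n<n)

pathNonCrossing : ∀ k (Ps : List (List (Fin (N k)))) P → P ∈ Ps → NonCrossing k Ps →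
  ∀ e f → e ∈ edges k P → f ∈ edges k P → ¬ Crosses k e f
pathNonCrossing k Ps P P∈Ps nc e f e∈ f∈ =
  nc e f (∈-concat⁺′ e∈ (∈-map⁺ (edges k) P∈Ps)) (∈-concat⁺′ f∈ (∈-map⁺ (edges k) P∈Ps))

lemma7 : (k : ℕ) (col : Fin (N k) → Bool) → PeriodicColouring k col →
    (Ps : List (List (Fin (N k)))) →
    All (IsAlternatingPath k col) Ps →
    AllPairs (Disjoint k) Ps →
    Covers k Ps →
    NonCrossing k Ps →
    (P : List (Fin (N k))) → P ∈ Ps → IsLeaf k P →
    weight2 k col P ≤ 7
-- paths are nonempty
lemma7 k col _ Ps alt _ _ _ [] P∈Ps _ = ⊥-elim (proj₁ (lookup alt P∈Ps) refl)
lemma7 k col (o , periodic) Ps alt _ _ nc (v₁ ∷ rest) P∈Ps (b , ℓ , base , unique) =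
  ≤-trans (WeightBound.weightBound k col P b ℓ t colour inBase (proj₁ (proj₁ base)) ℓ≤15)
          (subst (λ L → WindowWeight.windowWeight t L ≤ 7) (sym ℓ≡) (proj₂ smallAndLight))
  where
  P : List (Fin (N k))
  P = v₁ ∷ rest
  t : ℕ
  t = Phase.phase k col o periodic b
  colour : ∀ x → col x ≡ Pattern.pat t (Circle.offset k b x)
  colour = Phase.colour-from k col o periodic b
  inBase : ∀ x → x ∈ P → Circle.offset k b x < ℓ
  inBase x x∈ = Circle.∈interval⇒offset< k b ℓ x (proj₂ (proj₁ base))
                  (Bases.leafVertices⊆base k P {b} {ℓ} base unique x x∈)
  open LeafPeeling k col t b ℓ colour v₁ rest (proj₁ (proj₂ (lookup alt P∈Ps))) (proj₂ (proj₂ (lookup alt P∈Ps)))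
         (pathNonCrossing k Ps P P∈Ps nc) (proj₂ (proj₁ base)) (proj₁ (proj₂ base)) inBase
         using (σ; p; ℓ≡; peels)
  smallAndLight : (σ + p < 15) × (WindowWeight.windowWeight t (suc (σ + p)) ≤ 7)
  smallAndLight = PeelableBases.peelableBase t σ p (m%n<n (toℕ b + o) 16) peels
  ℓ≤15 : ℓ ≤ 15
  ℓ≤15 = subst (_≤ 15) (sym ℓ≡) (proj₁ smallAndLight)
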